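{- Let $p$ be an odd prime, $r$ a positive integer, and $n$ a positive integer. Every (not necessarily homogeneous) $\Sigma\Pi\Sigma$ circuit over $\mathrm{GF}(p^r)$ computing $S_n^2(X_1,\dots,X_n)$ has at least: (1) $\lceil \frac{n}{2}\rceil$ multiplication gates if $n$ is even; (2) $\lceil\frac{n}{2}\rceil$ multiplication gates if $n$ is odd and $n \not\equiv 1, -1, 3 \pmod p$; (3) $\lfloor \frac{n}{2}\rfloor$ multiplication gates if $n$ is odd and $n \equiv 1,-1,3 \pmod p$.
   Context: $S_n^2(X_1,\dots,X_n) = \sum_{1\le i<j\le n} X_iX_j$. A $\Sigma\Pi\Sigma$ circuit over a field $\mathbb{F}$ in variables $X_1,\dots,X_n$ is an expression $\sum_{i=1}^r \prod_{j=1}^{s_i} L_{ij}(X)$ where each $L_{ij}$ is a linear form $a_0+\sum_{k=1}^n a_kX_k$ with $a_0,\dots,a_n\in\mathbb{F}$ (constant terms allowed); the number of products is its number of multiplication gates. It computes a polynomial $P$ if the expression equals $P$ in $\mathbb{F}[X_1,\dots,X_n]$. -}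

module Defs where

open import Level using (Level; _⊔_)
open import Algebra.Bundles using (CommutativeRing)
open import Data.Nat as ℕ using (ℕ; zero; suc; _^_; _<?_)
import Data.Nat.Properties as ℕP
open import Data.Fin using (Fin; toℕ)
open import Data.List using (List; []; _∷_; map; concatMap; foldr; length; allFin; filter)
open import Data.Vec using (Vec; replicate; zipWith; updateAt)
import Data.Vec.Properties as VecP
open import Data.Product using (_×_; _,_; proj₁; proj₂; Σ; ∃)
open import Relation.Binary.PropositionalEquality using (_≡_)
open import Relation.Nullary using (¬_; yes; no)

record IsGF {c ℓ : Level} (q : ℕ) (R : CommutativeRing c ℓ) : Set (c ⊔ ℓ) where
  open CommutativeRing R
  field
    nontrivial : ¬ (1# ≈ 0#)
    inverse    : ∀ x → ¬ (x ≈ 0#) → Σ Carrier (λ y → (x * y) ≈ 1#)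
    enum       : Fin q → Carrier
    enum-surj  : ∀ x → Σ (Fin q) (λ i → enum i ≈ x)
    enum-inj   : ∀ i j → enum i ≈ enum j → i ≡ j

-- Polynomials in F[X_1..X_n] as finite formal sums of terms
-- (coefficient, exponent vector); equality of polynomials is equality
-- of all coefficients.

module Poly {c ℓ : Level} (R : CommutativeRing c ℓ) where
  open CommutativeRing R

  Monomial : ℕ → Set
  Monomial n = Vec ℕ n

  Polynomial : ℕ → Set c
  Polynomial n = List (Carrier × Monomial n)

  one-mon : ∀ {n} → Monomial n
  one-mon = replicate _ 0

  var-mon : ∀ {n} → Fin n → Monomial n
  var-mon i = updateAt one-mon i (λ _ → 1)

  coeff : ∀ {n} → Monomial n → Polynomial n → Carrier
  coeff m [] = 0#
  coeff m ((a , m′) ∷ P) with VecP.≡-dec ℕP._≟_ m m′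
  ... | yes _ = a + coeff m P
  ... | no  _ = coeff m P

  _≈P_ : ∀ {n} → Polynomial n → Polynomial n → Set ℓ
  P ≈P Q = ∀ m → coeff m P ≈ coeff m Q

  polyMul : ∀ {n} → Polynomial n → Polynomial n → Polynomial n
  polyMul P Q = concatMap (λ t → map (λ s → (proj₁ t * proj₁ s , zipWith ℕ._+_ (proj₂ t) (proj₂ s))) Q) P

  polyOne : ∀ {n} → Polynomial n
  polyOne = (1# , one-mon) ∷ []

  LinearForm : ℕ → Set c
  LinearForm n = Carrier × (Fin n → Carrier)

  linPoly : ∀ {n} → LinearForm n → Polynomial n
  linPoly {n} (a₀ , a) = (a₀ , one-mon) ∷ map (λ k → (a k , var-mon k)) (allFin n)

  -- ΣΠΣ circuit: a list of multiplication gates, each a list of linear forms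
  Circuit : ℕ → Set c
  Circuit n = List (List (LinearForm n))

  gates : ∀ {n} → Circuit n → ℕ
  gates = length

  gatePoly : ∀ {n} → List (LinearForm n) → Polynomial n
  gatePoly = foldr (λ L P → polyMul (linPoly L) P) polyOne

  circuitPoly : ∀ {n} → Circuit n → Polynomial n
  circuitPoly = concatMap gatePoly

  S2 : (n : ℕ) → Polynomial n
  S2 n = concatMap (λ i → map (λ j → (1# , zipWith ℕ._+_ (var-mon i) (var-mon j)))
                              (filter (λ j → toℕ i <? toℕ j) (allFin n)))
                   (allFin n)

  Computes : ∀ {n} → Circuit n → Polynomial n → Set ℓ
  Computes C P = circuitPoly C ≈P P

{-# OPTIONS --safe #-}

-- A circuit computing S₂ = Σ_{i<j} X_i X_j agrees with it as a function on Fⁿ. Go through the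
-- multiplication gates keeping an affine subspace, in reduced echelon form, on which S₂ minus the
-- gates not yet seen is constant: a gate all of whose factors are constant on the subspace is
-- absorbed into the constant, otherwise one factor is made to vanish by cutting the subspace by a
-- hyperplane. With s gates this ends with S₂ constant on some v + W with dim W = m ≥ n − s.
-- As 2 is invertible, S₂ and its polar form S₁(x)S₁(z) − ⟨x, z⟩ vanish on W. For the echelon
-- basis w_j of W, whose pivot coordinates form the identity and whose other n − m coordinates
-- form a matrix a, this reads S₁(w_i) S₁(w_j) = δ_ij + (aᵀa)_ij, a factorisation of the m × m
-- identity through F^(n−m+1); so m ≤ n − m + 1 and n ≤ 2s + 1. If n − 1 is invertible in F,
-- i.e. n ≢ 1 (mod p), the identity also factors through F^(n−m), giving n ≤ 2s.

module Submission where

open import Level using (_⊔_)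
open import Algebra.Bundles using (CommutativeRing)
open import Algebra.Solver.Ring.AlmostCommutativeRing using (_-Raw-AlmostCommutative⟶_; fromCommutativeRing)
import Algebra.Solver.Ring
open import Data.Bool using (true; false; if_then_else_)
open import Data.Fin as Fin using (Fin; zero; suc; punchIn; _↑ˡ_; _↑ʳ_)
import Data.Fin.Properties as Fin
open import Data.Fin.Permutation using (Permutation; ↔⇒≡)
open import Data.Integer as ℤ using (ℤ; +_; -[1+_]; _⊖_; _◃_; sign; ∣_∣)
import Data.Integer.Properties as ℤ
open import Data.List using (List; []; _∷_; length; _++_; map; concatMap; tabulate; filter; allFin; deduplicate)
open import Data.List.Membership.Propositional using (_∈_)
open import Data.List.Membership.Propositional.Properties using (∈-deduplicate⁺; ∈-++⁺ˡ; ∈-++⁺ʳ; ∈-map⁺)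
open import Data.List.Relation.Unary.All as All using (All; []; _∷_)
open import Data.List.Relation.Unary.AllPairs using ([]; _∷_)
open import Data.List.Relation.Unary.Any using (here; there)
open import Data.List.Relation.Unary.Unique.Propositional using (Unique)
open import Data.List.Relation.Unary.Unique.DecPropositional.Properties using (deduplicate-!)
import Data.Maybe as Maybe
open import Data.Nat as ℕ using (ℕ; zero; suc; _≤_; z≤n; s≤s; _^_; _≥_; _%_; ⌈_/2⌉; ⌊_/2⌋; NonZero)
import Data.Nat.Properties as ℕ
open import Data.Nat.Coprimality using (Coprime; coprime-Bézout)
open import Data.Nat.Divisibility using (_∣_; divides; ∣⇒≤)
open import Data.Nat.DivMod using ([m+kn]%n≡m%n)
open import Data.Nat.GCD using (module Bézout)
open import Data.Nat.Primality using (Prime; prime⇒irreducible; ¬prime[0]; ¬prime[1])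
open import Data.Product using (∃; ∃₂; _×_; _,_; proj₁; proj₂)
open import Data.Sign as Sign using (Sign)
open import Data.Sum using (_⊎_; inj₁; inj₂; [_,_])
import Data.Vec as Vec
import Data.Vec.Properties as Vec
open import Data.Vec.Functional using (Vector; head; tail; insertAt)
import Data.Vec.Functional.Properties as Vector
open import Function.Bundles using (Inverse; _↔_; mk↔ₛ′)
open import Function.Properties.Inverse using (↔-sym; ↔-trans)
open import Relation.Binary.Definitions using (Decidable)
open import Relation.Binary.PropositionalEquality as ≡ using (_≡_)
open import Relation.Nullary using (¬_; Dec; yes; no; does; ¬?)
open import Relation.Nullary.Decidable using (dec⇒maybe; decidable-stable)
open import Relation.Nullary.Negation using (contradiction)

open import Defs

dimension-count : ∀ {n m t s e} → n ≤ m ℕ.+ s → m ≤ e ℕ.+ t → m ℕ.+ t ≡ n → n ≤ e ℕ.+ (s ℕ.+ s)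
dimension-count {n} {m} {t} {s} {e} n≤m+s m≤e+t m+t≡n = ℕ.+-cancelˡ-≤ n n (e ℕ.+ (s ℕ.+ s)) (begin
  n ℕ.+ n                             ≤⟨ ℕ.+-mono-≤ n≤m+s n≤m+s ⟩
  (m ℕ.+ s) ℕ.+ (m ℕ.+ s)             ≤⟨ ℕ.+-monoʳ-≤ (m ℕ.+ s) (ℕ.+-monoˡ-≤ s m≤e+t) ⟩
  (m ℕ.+ s) ℕ.+ ((e ℕ.+ t) ℕ.+ s)     ≡⟨ solve 4 (λ m s e t → (m :+ s) :+ ((e :+ t) :+ s) := (m :+ t) :+ (e :+ (s :+ s)))
                                                  ≡.refl m s e t ⟩
  (m ℕ.+ t) ℕ.+ (e ℕ.+ (s ℕ.+ s))     ≡⟨ ≡.cong (ℕ._+ (e ℕ.+ (s ℕ.+ s))) m+t≡n ⟩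
  n ℕ.+ (e ℕ.+ (s ℕ.+ s))             ∎)
  where
  open ℕ.≤-Reasoning
  open import Data.Nat.Solver using (module +-*-Solver)
  open +-*-Solver

module IntegerCoefficients {c ℓ} (R : CommutativeRing c ℓ) where
  open CommutativeRing R hiding (zero)
  open import Algebra.Properties.Semiring.Mult.TCOptimised semiring
    using (×-homo-+; ×1-homo-*; 1+×) renaming (_×_ to _×ᴿ_)
  open import Algebra.Properties.Ring ring using (-‿involutive; -‿distribˡ-*; -0#≈0#)
  open import Algebra.Properties.AbelianGroup +-abelianGroup using (⁻¹-∙-comm)
  open import Relation.Binary.Reasoning.Setoid setoid

  fromℕ : ℕ → Carrier
  fromℕ n = n ×ᴿ 1#

  fromℤ : ℤ → Carrier
  fromℤ (+ n)    = fromℕ n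
  fromℤ -[1+ n ] = - fromℕ (suc n)

  fromℕ-suc-1≈fromℕ : ∀ n → fromℕ (suc n) - 1# ≈ fromℕ n
  fromℕ-suc-1≈fromℕ n = begin
    fromℕ (suc n) - 1#       ≈⟨ +-congʳ (1+× n 1#) ⟩
    1# + fromℕ n - 1#        ≈⟨ +-congʳ (+-comm 1# (fromℕ n)) ⟩
    fromℕ n + 1# - 1#        ≈⟨ +-assoc _ _ _ ⟩
    fromℕ n + (1# - 1#)      ≈⟨ +-congˡ (-‿inverseʳ 1#) ⟩
    fromℕ n + 0#             ≈⟨ +-identityʳ _ ⟩
    fromℕ n                  ∎

  fromSign : Sign → Carrier
  fromSign Sign.+ = 1#
  fromSign Sign.- = - 1#

  private
    x+-y≈[1+x]+-[1+y] : ∀ x y → x - y ≈ (1# + x) - (1# + y)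
    x+-y≈[1+x]+-[1+y] x y = begin
      x - y                       ≈⟨ +-congˡ (+-identityˡ _) ⟨
      x + (0# - y)                ≈⟨ +-congˡ (+-congʳ (-‿inverseʳ 1#)) ⟨
      x + ((1# - 1#) - y)         ≈⟨ +-congˡ (+-assoc _ _ _) ⟩
      x + (1# + (- 1# - y))       ≈⟨ +-assoc _ _ _ ⟨
      (x + 1#) + (- 1# - y)       ≈⟨ +-cong (+-comm _ _) (⁻¹-∙-comm _ _) ⟩
      (1# + x) - (1# + y)         ∎

  fromℤ-⊖ : ∀ m n → fromℤ (m ⊖ n) ≈ fromℕ m - fromℕ n
  fromℤ-⊖ zero    zero    = sym (trans (+-congˡ -0#≈0#) (+-identityʳ _))
  fromℤ-⊖ zero    (suc n) = sym (+-identityˡ _)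
  fromℤ-⊖ (suc m) zero    = sym (trans (+-congˡ -0#≈0#) (+-identityʳ _))
  fromℤ-⊖ (suc m) (suc n) = begin
    fromℤ (suc m ⊖ suc n)              ≡⟨ ≡.cong fromℤ (ℤ.[1+m]⊖[1+n]≡m⊖n m n) ⟩
    fromℤ (m ⊖ n)                      ≈⟨ fromℤ-⊖ m n ⟩
    fromℕ m - fromℕ n                  ≈⟨ x+-y≈[1+x]+-[1+y] _ _ ⟩
    (1# + fromℕ m) - (1# + fromℕ n)    ≈⟨ +-cong (1+× m 1#) (-‿cong (1+× n 1#)) ⟨
    fromℕ (suc m) - fromℕ (suc n)      ∎

  fromℤ-+ : ∀ i j → fromℤ (i ℤ.+ j) ≈ fromℤ i + fromℤ j
  fromℤ-+ (+ m)    (+ n)    = ×-homo-+ 1# m n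
  fromℤ-+ (+ m)    -[1+ n ] = fromℤ-⊖ m (suc n)
  fromℤ-+ -[1+ m ] (+ n)    = trans (fromℤ-⊖ n (suc m)) (+-comm _ _)
  fromℤ-+ -[1+ m ] -[1+ n ] = begin
    - fromℕ (suc (suc m ℕ.+ n))        ≡⟨ ≡.cong (λ k → - fromℕ (suc k)) (ℕ.+-suc m n) ⟨
    - fromℕ (suc m ℕ.+ suc n)          ≈⟨ -‿cong (×-homo-+ 1# (suc m) (suc n)) ⟩
    - (fromℕ (suc m) + fromℕ (suc n))  ≈⟨ ⁻¹-∙-comm _ _ ⟨
    - fromℕ (suc m) - fromℕ (suc n)    ∎

  fromSign-* : ∀ s t → fromSign (s Sign.* t) ≈ fromSign s * fromSign t
  fromSign-* Sign.+ _      = sym (*-identityˡ _)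
  fromSign-* Sign.- Sign.+ = sym (*-identityʳ _)
  fromSign-* Sign.- Sign.- = begin
    1#            ≈⟨ -‿involutive 1# ⟨
    - - 1#        ≈⟨ -‿cong (*-identityʳ _) ⟨
    - (- 1# * 1#) ≈⟨ -‿distribʳ-* _ _ ⟩
    - 1# * - 1#   ∎
    where open import Algebra.Properties.Ring ring using (-‿distribʳ-*)

  fromℤ-◃ : ∀ s n → fromℤ (s ◃ n) ≈ fromSign s * fromℕ n
  fromℤ-◃ s      zero    = sym (zeroʳ _)
  fromℤ-◃ Sign.+ (suc n) = sym (*-identityˡ _)
  fromℤ-◃ Sign.- (suc n) = trans (-‿cong (sym (*-identityˡ _))) (-‿distribˡ-* _ _)

  fromℤ-sign-abs : ∀ i → fromℤ i ≈ fromSign (sign i) * fromℕ ∣ i ∣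
  fromℤ-sign-abs i = trans (reflexive (≡.cong fromℤ (≡.sym (ℤ.◃-inverse i)))) (fromℤ-◃ (sign i) ∣ i ∣)

  fromℤ-* : ∀ i j → fromℤ (i ℤ.* j) ≈ fromℤ i * fromℤ j
  fromℤ-* i j = begin
    fromℤ (sign i Sign.* sign j ◃ ∣ i ∣ ℕ.* ∣ j ∣)
      ≈⟨ fromℤ-◃ (sign i Sign.* sign j) (∣ i ∣ ℕ.* ∣ j ∣) ⟩
    fromSign (sign i Sign.* sign j) * fromℕ (∣ i ∣ ℕ.* ∣ j ∣)
      ≈⟨ *-cong (fromSign-* (sign i) (sign j)) (×1-homo-* ∣ i ∣ ∣ j ∣) ⟩
    (fromSign (sign i) * fromSign (sign j)) * (fromℕ ∣ i ∣ * fromℕ ∣ j ∣)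
      ≈⟨ interchange _ _ _ _ ⟩
    (fromSign (sign i) * fromℕ ∣ i ∣) * (fromSign (sign j) * fromℕ ∣ j ∣)
      ≈⟨ *-cong (fromℤ-sign-abs i) (fromℤ-sign-abs j) ⟨
    fromℤ i * fromℤ j ∎
    where open import Algebra.Properties.CommutativeSemigroup *-commutativeSemigroup using (interchange)

  fromℤ-neg : ∀ i → fromℤ (ℤ.- i) ≈ - fromℤ i
  fromℤ-neg (+ zero)  = sym -0#≈0#
  fromℤ-neg (+ suc n) = refl
  fromℤ-neg -[1+ n ]  = sym (-‿involutive _)

  fromℤ-homomorphism : ℤ.+-*-rawRing -Raw-AlmostCommutative⟶ fromCommutativeRing R
  fromℤ-homomorphism = record
    { ⟦_⟧ = fromℤ ; +-homo = fromℤ-+ ; *-homo = fromℤ-* ; -‿homo = fromℤ-neg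
    ; 0-homo = refl ; 1-homo = refl }

  fromℤ-≡-weaklyDecidable : ∀ i j → Maybe.Maybe (fromℤ i ≈ fromℤ j)
  fromℤ-≡-weaklyDecidable i j = Maybe.map (λ i≡j → reflexive (≡.cong fromℤ i≡j)) (dec⇒maybe (i ℤ.≟ j))

  open Algebra.Solver.Ring ℤ.+-*-rawRing (fromCommutativeRing R) fromℤ-homomorphism fromℤ-≡-weaklyDecidable public

module Sums {c ℓ} (R : CommutativeRing c ℓ) where
  open CommutativeRing R hiding (zero)
  open IntegerCoefficients R using (fromℕ; solve; _:=_; _:+_; _:*_; con)
  open import Algebra.Properties.Semiring.Mult.TCOptimised semiring using (1+×)
  open import Algebra.Properties.Ring ring using (-0#≈0#)
  open import Algebra.Properties.AbelianGroup +-abelianGroup using (⁻¹-∙-comm)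
  open import Algebra.Properties.Semiring.Sum semiring public
  open import Relation.Binary.Reasoning.Setoid setoid

  ∑-*ˡ : ∀ {n} a (f : Vector Carrier n) → ∑[ i < n ] (a * f i) ≈ a * ∑[ i < n ] f i
  ∑-*ˡ a f = sym (*-distribˡ-sum a f)

  ∑-*ʳ : ∀ {n} a (f : Vector Carrier n) → ∑[ i < n ] (f i * a) ≈ (∑[ i < n ] f i) * a
  ∑-*ʳ a f = sym (*-distribʳ-sum a f)

  ∑-neg : ∀ {n} (f : Vector Carrier n) → ∑[ i < n ] (- f i) ≈ - ∑[ i < n ] f i
  ∑-neg {zero}  f = sym -0#≈0#
  ∑-neg {suc n} f = trans (+-congˡ (∑-neg (λ i → f (suc i)))) (⁻¹-∙-comm _ _)

  ∑-const : ∀ n a → ∑[ i < n ] a ≈ fromℕ n * a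
  ∑-const zero    a = sym (zeroˡ a)
  ∑-const (suc n) a = begin
    a + ∑[ i < n ] a    ≈⟨ +-congˡ (∑-const n a) ⟩
    a + fromℕ n * a     ≈⟨ solve 2 (λ a m → a :+ m :* a := (con (+ 1) :+ m) :* a) refl a (fromℕ n) ⟩
    (1# + fromℕ n) * a  ≈⟨ *-congʳ (1+× n 1#) ⟨
    fromℕ (suc n) * a   ∎

  ∑-linear : ∀ {n} (f g : Vector Carrier n) a → ∑[ i < n ] (f i - a * g i) ≈ ∑[ i < n ] f i - a * ∑[ i < n ] g i
  ∑-linear f g a = trans (∑-distrib-+ f (λ i → - (a * g i))) (+-congˡ (trans (∑-neg (λ i → a * g i)) (-‿cong (∑-*ˡ a g))))

  ∑-↑ : ∀ m n (f : Vector Carrier (m ℕ.+ n)) →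
        ∑[ k < m ℕ.+ n ] f k ≈ ∑[ i < m ] f (i ↑ˡ n) + ∑[ j < n ] f (m ↑ʳ j)
  ∑-↑ zero    n f = sym (+-identityˡ _)
  ∑-↑ (suc m) n f = trans (+-congˡ (∑-↑ m n (λ k → f (suc k)))) (sym (+-assoc _ _ _))

  δ : ∀ {n} → Fin n → Fin n → Carrier
  δ i j with i Fin.≟ j
  ... | yes _ = 1#
  ... | no  _ = 0#

  δ-diag : ∀ {n} (i : Fin n) → δ i i ≈ 1#
  δ-diag i with i Fin.≟ i
  ... | yes _   = refl
  ... | no  i≢i = contradiction ≡.refl i≢i

  δ-off : ∀ {n} {i j : Fin n} → ¬ i ≡ j → δ i j ≈ 0#
  δ-off {i = i} {j} i≢j with i Fin.≟ j
  ... | yes i≡j = contradiction i≡j i≢j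
  ... | no  _   = refl

  δ-sym : ∀ {n} (i j : Fin n) → δ i j ≈ δ j i
  δ-sym i j with i Fin.≟ j
  ... | yes ≡.refl = sym (δ-diag i)
  ... | no  i≢j    = sym (δ-off (λ j≡i → i≢j (≡.sym j≡i)))

  δ-punchIn : ∀ {n} (k : Fin (suc n)) (i j : Fin n) → δ (punchIn k i) (punchIn k j) ≈ δ i j
  δ-punchIn k i j with i Fin.≟ j
  ... | yes ≡.refl = δ-diag (punchIn k i)
  ... | no  i≢j    = δ-off (λ e → i≢j (Fin.punchIn-injective k i j e))

  δ-punchIn-pivot : ∀ {n} (k : Fin (suc n)) (i : Fin n) → δ (punchIn k i) k ≈ 0#
  δ-punchIn-pivot k i = δ-off (Fin.punchInᵢ≢i k i)

  ∑-δ : ∀ {n} (f : Vector Carrier n) j → ∑[ i < n ] (f i * δ i j) ≈ f j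
  ∑-δ {suc n} f j = begin
    ∑[ i < suc n ] (f i * δ i j)
      ≈⟨ sum-remove {i = j} (λ i → f i * δ i j) ⟩
    f j * δ j j + ∑[ i < n ] (f (punchIn j i) * δ (punchIn j i) j)
      ≈⟨ +-cong (*-congˡ (δ-diag j)) (sum-cong-≋ (λ i → *-congˡ (δ-punchIn-pivot j i))) ⟩
    f j * 1# + ∑[ i < n ] (f (punchIn j i) * 0#)
      ≈⟨ +-cong (*-identityʳ _) (trans (sum-cong-≋ (λ i → zeroʳ (f (punchIn j i)))) (sum-replicate-zero n)) ⟩
    f j + 0#
      ≈⟨ +-identityʳ _ ⟩
    f j ∎

module ElementarySymmetric {c ℓ} (R : CommutativeRing c ℓ) where
  open CommutativeRing R hiding (zero)
  open IntegerCoefficients R using (solve; _:=_; _:+_; _:*_; :-_; _:-_; con)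
  open Sums R
  open import Relation.Binary.Reasoning.Setoid setoid

  S₁ : ∀ {n} → Vector Carrier n → Carrier
  S₁ x = ∑[ i < _ ] x i

  S₂ : ∀ {n} → Vector Carrier n → Carrier
  S₂ {zero}  x = 0#
  S₂ {suc n} x = head x * S₁ (tail x) + S₂ (tail x)

  dot : ∀ {n} → Vector Carrier n → Vector Carrier n → Carrier
  dot x z = ∑[ i < _ ] (x i * z i)

  polar : ∀ {n} → Vector Carrier n → Vector Carrier n → Carrier
  polar x z = S₁ x * S₁ z - dot x z

  _⊕_ : ∀ {n} → Vector Carrier n → Vector Carrier n → Vector Carrier n
  (x ⊕ z) i = x i + z i

  _·_ : ∀ {n} → Carrier → Vector Carrier n → Vector Carrier n
  (a · x) i = a * x i

  S₂-cong : ∀ {n} {x z : Vector Carrier n} → (∀ i → x i ≈ z i) → S₂ x ≈ S₂ z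
  S₂-cong {zero}  x≈z = refl
  S₂-cong {suc n} x≈z =
    +-cong (*-cong (x≈z zero) (sum-cong-≋ (λ i → x≈z (suc i)))) (S₂-cong (λ i → x≈z (suc i)))

  S₂-⊕ : ∀ {n} (x z : Vector Carrier n) → S₂ (x ⊕ z) ≈ S₂ x + S₂ z + polar x z
  S₂-⊕ {zero}  x z = solve 0 (con (+ 0) := con (+ 0) :+ con (+ 0) :+ (con (+ 0) :* con (+ 0) :- con (+ 0))) refl
  S₂-⊕ {suc n} x z = begin
    (head x + head z) * S₁ (tail x ⊕ tail z) + S₂ (tail x ⊕ tail z)
      ≈⟨ +-cong (*-congˡ (∑-distrib-+ (tail x) (tail z))) (S₂-⊕ (tail x) (tail z)) ⟩
    (head x + head z) * (S₁ (tail x) + S₁ (tail z)) + (S₂ (tail x) + S₂ (tail z) + polar (tail x) (tail z))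
      ≈⟨ solve 7 (λ a b sa sb qa qb d → (a :+ b) :* (sa :+ sb) :+ (qa :+ qb :+ (sa :* sb :- d))
                   := a :* sa :+ qa :+ (b :* sb :+ qb) :+ ((a :+ sa) :* (b :+ sb) :- (a :* b :+ d)))
               refl (head x) (head z) (S₁ (tail x)) (S₁ (tail z)) (S₂ (tail x)) (S₂ (tail z)) (dot (tail x) (tail z)) ⟩
    S₂ x + S₂ z + polar x z ∎

  S₂-· : ∀ {n} a (x : Vector Carrier n) → S₂ (a · x) ≈ a * a * S₂ x
  S₂-· {zero}  a x = sym (zeroʳ _)
  S₂-· {suc n} a x = begin
    a * head x * S₁ (a · tail x) + S₂ (a · tail x)
      ≈⟨ +-cong (*-congˡ (∑-*ˡ a (tail x))) (S₂-· a (tail x)) ⟩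
    a * head x * (a * S₁ (tail x)) + a * a * S₂ (tail x)
      ≈⟨ solve 4 (λ a b s q → a :* b :* (a :* s) :+ a :* a :* q := a :* a :* (b :* s :+ q))
               refl a (head x) (S₁ (tail x)) (S₂ (tail x)) ⟩
    a * a * S₂ x ∎

  polar-·ʳ : ∀ {n} a (x z : Vector Carrier n) → polar x (a · z) ≈ a * polar x z
  polar-·ʳ a x z = begin
    S₁ x * S₁ (a · z) - dot x (a · z)
      ≈⟨ +-cong (*-congˡ (∑-*ˡ a z))
                (-‿cong (trans (sum-cong-≋ (λ i → x∙yz≈y∙xz (x i) a (z i))) (∑-*ˡ a (λ i → x i * z i)))) ⟩
    S₁ x * (a * S₁ z) - a * dot x z
      ≈⟨ solve 4 (λ s a t d → s :* (a :* t) :- a :* d := a :* (s :* t :- d)) refl (S₁ x) a (S₁ z) (dot x z) ⟩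
    a * polar x z ∎
    where open import Algebra.Properties.CommutativeSemigroup *-commutativeSemigroup using (x∙yz≈y∙xz)

  module _ (½ : Carrier) (½*2≈1 : ½ * (1# + 1#) ≈ 1#) where

    invariant±⇒isotropic : ∀ {n} (v w : Vector Carrier n) →
      S₂ (v ⊕ w) ≈ S₂ v → S₂ (v ⊕ ((- 1#) · w)) ≈ S₂ v → S₂ w ≈ 0#
    -- Adding the expansions of S₂ (v ± w) leaves 2 · S₂ w = 0.
    invariant±⇒isotropic v w +w-inv -w-inv = begin
      S₂ w
        ≈⟨ solve 4 (λ h A q p → q := h :* ((A :+ q :+ p) :+ (A :+ (:- con (+ 1)) :* (:- con (+ 1)) :* q :+ (:- con (+ 1)) :* p)
                                              :- (A :+ A))
                                        :+ q :* (con (+ 1) :- h :* (con (+ 1) :+ con (+ 1))))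
                 refl ½ (S₂ v) (S₂ w) (polar v w) ⟩
      ½ * ((S₂ v + S₂ w + polar v w) + (S₂ v + - 1# * - 1# * S₂ w + - 1# * polar v w) - (S₂ v + S₂ v))
        + S₂ w * (1# - ½ * (1# + 1#))
        ≈⟨ +-cong (*-congˡ (+-congʳ (+-cong sum₊ sum₋)))
                  (*-congˡ (trans (+-congˡ (-‿cong ½*2≈1)) (-‿inverseʳ 1#))) ⟩
      ½ * ((S₂ v + S₂ v) - (S₂ v + S₂ v)) + S₂ w * 0#
        ≈⟨ trans (+-cong (trans (*-congˡ (-‿inverseʳ _)) (zeroʳ ½)) (zeroʳ _)) (+-identityʳ 0#) ⟩
      0# ∎
      where
      sum₊ : S₂ v + S₂ w + polar v w ≈ S₂ v
      sum₊ = trans (sym (S₂-⊕ v w)) +w-inv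
      sum₋ : S₂ v + - 1# * - 1# * S₂ w + - 1# * polar v w ≈ S₂ v
      sum₋ = trans (sym (+-cong (+-congˡ (S₂-· (- 1#) w)) (polar-·ʳ (- 1#) v w)))
                   (trans (sym (S₂-⊕ v ((- 1#) · w))) -w-inv)

  isotropic⇒polar≈0 : ∀ {n} (w w′ : Vector Carrier n) →
                      S₂ w ≈ 0# → S₂ w′ ≈ 0# → S₂ (w ⊕ w′) ≈ 0# → polar w w′ ≈ 0#
  isotropic⇒polar≈0 w w′ w≈0 w′≈0 w+w′≈0 = begin
    polar w w′                         ≈⟨ +-identityˡ _ ⟨
    0# + polar w w′                    ≈⟨ +-congʳ (trans (+-cong w≈0 w′≈0) (+-identityʳ 0#)) ⟨
    S₂ w + S₂ w′ + polar w w′          ≈⟨ S₂-⊕ w w′ ⟨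
    S₂ (w ⊕ w′)                        ≈⟨ w+w′≈0 ⟩
    0# ∎

module PolynomialEvaluation {c ℓ} (R : CommutativeRing c ℓ) where
  open CommutativeRing R hiding (zero)
  open import Algebra.Properties.Semiring.Exp semiring using (^-homo-*) renaming (_^_ to _^′_)
  open IntegerCoefficients R using (solve; _:=_; _:+_)
  open Sums R
  open ElementarySymmetric R using (S₂)
  open Poly R
  open import Relation.Binary.Reasoning.Setoid setoid

  listSum : ∀ {a} {A : Set a} → (A → Carrier) → List A → Carrier
  listSum f []       = 0#
  listSum f (a ∷ as) = f a + listSum f as

  module _ {a} {A : Set a} where

    listSum-cong : ∀ {f g : A → Carrier} (as : List A) → (∀ a → f a ≈ g a) → listSum f as ≈ listSum g as
    listSum-cong []       f≈g = refl
    listSum-cong (a ∷ as) f≈g = +-cong (f≈g a) (listSum-cong as f≈g)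

    listSum-++ : ∀ (f : A → Carrier) as bs → listSum f (as ++ bs) ≈ listSum f as + listSum f bs
    listSum-++ f []       bs = sym (+-identityˡ _)
    listSum-++ f (a ∷ as) bs = trans (+-congˡ (listSum-++ f as bs)) (sym (+-assoc _ _ _))

    listSum-+ : ∀ (f g : A → Carrier) as → listSum (λ a → f a + g a) as ≈ listSum f as + listSum g as
    listSum-+ f g []       = sym (+-identityʳ _)
    listSum-+ f g (a ∷ as) = trans (+-congˡ (listSum-+ f g as))
      (solve 4 (λ a b c d → a :+ b :+ (c :+ d) := a :+ c :+ (b :+ d)) refl (f a) (g a) (listSum f as) (listSum g as))

    listSum-*ʳ : ∀ (f : A → Carrier) b as → listSum (λ a → f a * b) as ≈ listSum f as * b
    listSum-*ʳ f b []       = sym (zeroˡ b)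
    listSum-*ʳ f b (a ∷ as) = trans (+-congˡ (listSum-*ʳ f b as)) (sym (distribʳ b _ _))

    listSum-*ˡ : ∀ (f : A → Carrier) b as → listSum (λ a → b * f a) as ≈ b * listSum f as
    listSum-*ˡ f b []       = sym (zeroʳ b)
    listSum-*ˡ f b (a ∷ as) = trans (+-congˡ (listSum-*ˡ f b as)) (sym (distribˡ b _ _))

    listSum-zero : ∀ (f : A → Carrier) as → (∀ a → f a ≈ 0#) → listSum f as ≈ 0#
    listSum-zero f []       f≈0 = refl
    listSum-zero f (a ∷ as) f≈0 = trans (+-cong (f≈0 a) (listSum-zero f as f≈0)) (+-identityʳ _)

    listSum-tabulate : ∀ {n} (f : A → Carrier) (g : Fin n → A) → listSum f (tabulate g) ≈ ∑[ i < n ] f (g i)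
    listSum-tabulate {zero}  f g = refl
    listSum-tabulate {suc n} f g = +-congˡ (listSum-tabulate f (λ i → g (suc i)))

  listSum-filter : ∀ {a p} {A : Set a} {P : A → Set p} (P? : ∀ a → Dec (P a)) (f : A → Carrier) as →
                   listSum f (filter P? as) ≈ listSum (λ a → if does (P? a) then f a else 0#) as
  listSum-filter P? f []       = refl
  listSum-filter P? f (a ∷ as) with does (P? a)
  ... | true  = +-congˡ (listSum-filter P? f as)
  ... | false = trans (listSum-filter P? f as) (sym (+-identityˡ _))

  listSum-map : ∀ {a b} {A : Set a} {B : Set b} (f : B → Carrier) (g : A → B) as →
                listSum f (map g as) ≈ listSum (λ a → f (g a)) as
  listSum-map f g []       = refl
  listSum-map f g (a ∷ as) = +-congˡ (listSum-map f g as)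

  listSum-concatMap : ∀ {a b} {A : Set a} {B : Set b} (f : B → Carrier) (g : A → List B) as →
                      listSum f (concatMap g as) ≈ listSum (λ a → listSum f (g a)) as
  listSum-concatMap f g []       = refl
  listSum-concatMap f g (a ∷ as) = trans (listSum-++ f (g a) (concatMap g as)) (+-congˡ (listSum-concatMap f g as))

  evalMonomial : ∀ {n} → Monomial n → Vector Carrier n → Carrier
  evalMonomial Vec.[]       x = 1#
  evalMonomial (e Vec.∷ m) x = head x ^′ e * evalMonomial m (tail x)

  evalTerm : ∀ {n} → Carrier × Monomial n → Vector Carrier n → Carrier
  evalTerm (a , m) x = a * evalMonomial m x

  eval : ∀ {n} → Polynomial n → Vector Carrier n → Carrier
  eval P x = listSum (λ t → evalTerm t x) P

  evalLinear : ∀ {n} → LinearForm n → Vector Carrier n → Carrier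
  evalLinear (a₀ , a) x = a₀ + ∑[ k < _ ] (a k * x k)

  evalGate : ∀ {n} → List (LinearForm n) → Vector Carrier n → Carrier
  evalGate []      x = 1#
  evalGate (L ∷ g) x = evalLinear L x * evalGate g x

  evalCircuit : ∀ {n} → Circuit n → Vector Carrier n → Carrier
  evalCircuit C x = listSum (λ g → evalGate g x) C

  evalLinear-cong : ∀ {n} (L : LinearForm n) {x z} → (∀ i → x i ≈ z i) → evalLinear L x ≈ evalLinear L z
  evalLinear-cong (a₀ , a) x≈z = +-congˡ (sum-cong-≋ (λ k → *-congˡ (x≈z k)))

  evalGate-cong : ∀ {n} (g : List (LinearForm n)) {x z} → (∀ i → x i ≈ z i) → evalGate g x ≈ evalGate g z
  evalGate-cong []      x≈z = refl
  evalGate-cong (L ∷ g) x≈z = *-cong (evalLinear-cong L x≈z) (evalGate-cong g x≈z)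

  evalCircuit-cong : ∀ {n} (C : Circuit n) {x z} → (∀ i → x i ≈ z i) → evalCircuit C x ≈ evalCircuit C z
  evalCircuit-cong C x≈z = listSum-cong C (λ g → evalGate-cong g x≈z)

  evalMonomial-+ : ∀ {n} (m m′ : Monomial n) x →
                   evalMonomial (Vec.zipWith ℕ._+_ m m′) x ≈ evalMonomial m x * evalMonomial m′ x
  evalMonomial-+ Vec.[]       Vec.[]         x = sym (*-identityˡ _)
  evalMonomial-+ (e Vec.∷ m) (e′ Vec.∷ m′) x = begin
    head x ^′ (e ℕ.+ e′) * evalMonomial (Vec.zipWith ℕ._+_ m m′) (tail x)
      ≈⟨ *-cong (^-homo-* (head x) e e′) (evalMonomial-+ m m′ (tail x)) ⟩
    (head x ^′ e * head x ^′ e′) * (evalMonomial m (tail x) * evalMonomial m′ (tail x))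
      ≈⟨ interchange _ _ _ _ ⟩
    (head x ^′ e * evalMonomial m (tail x)) * (head x ^′ e′ * evalMonomial m′ (tail x)) ∎
    where open import Algebra.Properties.CommutativeSemigroup *-commutativeSemigroup using (interchange)

  evalMonomial-one : ∀ {n} x → evalMonomial (one-mon {n}) x ≈ 1#
  evalMonomial-one {zero}  x = refl
  evalMonomial-one {suc n} x = trans (*-identityˡ _) (evalMonomial-one {n} (tail x))

  evalMonomial-var : ∀ {n} (k : Fin n) x → evalMonomial (var-mon k) x ≈ x k
  evalMonomial-var {suc n} zero    x =
    trans (*-cong (*-identityʳ _) (evalMonomial-one {n} (tail x))) (*-identityʳ _)
  evalMonomial-var {suc n} (suc k) x = trans (*-identityˡ _) (evalMonomial-var k (tail x))

  eval-polyMul : ∀ {n} (P P′ : Polynomial n) x → eval (polyMul P P′) x ≈ eval P x * eval P′ x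
  eval-polyMul P P′ x = begin
    eval (polyMul P P′) x
      ≈⟨ listSum-concatMap (λ t → evalTerm t x) _ P ⟩
    listSum (λ t → eval (map (λ s → (proj₁ t * proj₁ s , Vec.zipWith ℕ._+_ (proj₂ t) (proj₂ s))) P′) x) P
      ≈⟨ listSum-cong P (λ t → trans (listSum-map (λ t → evalTerm t x) _ P′)
                                     (trans (listSum-cong P′ (evalTerm-* t)) (listSum-*ˡ (λ s → evalTerm s x) _ P′))) ⟩
    listSum (λ t → evalTerm t x * eval P′ x) P
      ≈⟨ listSum-*ʳ (λ t → evalTerm t x) (eval P′ x) P ⟩
    eval P x * eval P′ x ∎
    where
    evalTerm-* : ∀ t s → evalTerm (proj₁ t * proj₁ s , Vec.zipWith ℕ._+_ (proj₂ t) (proj₂ s)) x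
                         ≈ evalTerm t x * evalTerm s x
    evalTerm-* (a , m) (b , m′) = begin
      a * b * evalMonomial (Vec.zipWith ℕ._+_ m m′) x       ≈⟨ *-congˡ (evalMonomial-+ m m′ x) ⟩
      a * b * (evalMonomial m x * evalMonomial m′ x)        ≈⟨ interchange _ _ _ _ ⟩
      a * evalMonomial m x * (b * evalMonomial m′ x)        ∎
      where open import Algebra.Properties.CommutativeSemigroup *-commutativeSemigroup using (interchange)

  eval-linPoly : ∀ {n} (L : LinearForm n) x → eval (linPoly L) x ≈ evalLinear L x
  eval-linPoly {n} (a₀ , a) x = +-cong
    (trans (*-congˡ (evalMonomial-one {n} x)) (*-identityʳ a₀))
    (trans (listSum-map (λ t → evalTerm t x) (λ k → (a k , var-mon k)) (allFin n))
    (trans (listSum-tabulate (λ k → a k * evalMonomial (var-mon k) x) (λ k → k))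
           (sum-cong-≋ (λ k → *-congˡ (evalMonomial-var k x)))))

  eval-gatePoly : ∀ {n} (g : List (LinearForm n)) x → eval (gatePoly g) x ≈ evalGate g x
  eval-gatePoly []      x = trans (+-identityʳ _) (trans (*-identityˡ _) (evalMonomial-one x))
  eval-gatePoly (L ∷ g) x =
    trans (eval-polyMul (linPoly L) (gatePoly g) x) (*-cong (eval-linPoly L x) (eval-gatePoly g x))

  eval-circuitPoly : ∀ {n} (C : Circuit n) x → eval (circuitPoly C) x ≈ evalCircuit C x
  eval-circuitPoly C x =
    trans (listSum-concatMap (λ t → evalTerm t x) gatePoly C) (listSum-cong C (λ g → eval-gatePoly g x))

  rowSum : ∀ {n} → Vector Carrier n → Fin n → Carrier
  rowSum {n} x i = ∑[ j < n ] (if does (Fin.toℕ i ℕ.<? Fin.toℕ j) then x i * x j else 0#)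

  pairSum : ∀ {n} → Vector Carrier n → Carrier
  pairSum {n} x = ∑[ i < n ] rowSum x i

  pairSum≈S₂ : ∀ {n} (x : Vector Carrier n) → pairSum x ≈ S₂ x
  pairSum≈S₂ {zero}  x = refl
  pairSum≈S₂ {suc n} x = +-cong
    (trans (+-identityˡ _) (∑-*ˡ (head x) (tail x)))
    (trans (sum-cong-≋ (λ i → +-identityˡ (rowSum (tail x) i))) (pairSum≈S₂ (tail x)))

  eval-S2 : ∀ n (x : Vector Carrier n) → eval (S2 n) x ≈ S₂ x
  eval-S2 n x = begin
    eval (S2 n) x
      ≈⟨ listSum-concatMap (λ t → evalTerm t x) (λ i → map (h i) (filter (i <?_) (allFin n))) (allFin n) ⟩
    listSum (λ i → eval (map (h i) (filter (i <?_) (allFin n))) x) (allFin n)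
      ≈⟨ listSum-tabulate (λ i → eval (map (h i) (filter (i <?_) (allFin n))) x) (λ i → i) ⟩
    ∑[ i < n ] eval (map (h i) (filter (i <?_) (allFin n))) x
      ≈⟨ sum-cong-≋ (λ i → row i) ⟩
    pairSum x
      ≈⟨ pairSum≈S₂ x ⟩
    S₂ x ∎
    where
    _<?_ : (i j : Fin n) → Dec (Fin.toℕ i ℕ.< Fin.toℕ j)
    i <? j = Fin.toℕ i ℕ.<? Fin.toℕ j
    h : Fin n → Fin n → Carrier × Monomial n
    h i j = (1# , Vec.zipWith ℕ._+_ (var-mon i) (var-mon j))
    evalTerm-h : ∀ i j → evalTerm (h i j) x ≈ x i * x j
    evalTerm-h i j = trans (*-identityˡ _)
      (trans (evalMonomial-+ (var-mon i) (var-mon j) x) (*-cong (evalMonomial-var i x) (evalMonomial-var j x)))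
    row : ∀ i → eval (map (h i) (filter (i <?_) (allFin n))) x ≈ rowSum x i
    row i = begin
      eval (map (h i) (filter (i <?_) (allFin n))) x
        ≈⟨ listSum-map (λ t → evalTerm t x) (h i) (filter (i <?_) (allFin n)) ⟩
      listSum (λ j → evalTerm (h i j) x) (filter (i <?_) (allFin n))
        ≈⟨ listSum-filter (i <?_) (λ j → evalTerm (h i j) x) (allFin n) ⟩
      listSum (λ j → if does (i <? j) then evalTerm (h i j) x else 0#) (allFin n)
        ≈⟨ listSum-tabulate (λ j → if does (i <? j) then evalTerm (h i j) x else 0#) (λ j → j) ⟩
      ∑[ j < n ] (if does (i <? j) then evalTerm (h i j) x else 0#)
        ≈⟨ sum-cong-≋ (λ j → if-cong (does (i <? j)) (evalTerm-h i j)) ⟩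
      rowSum x i ∎
      where
      if-cong : ∀ b {u v} → u ≈ v → (if b then u else 0#) ≈ (if b then v else 0#)
      if-cong true  u≈v = u≈v
      if-cong false _   = refl

  evalGate-vanishes : ∀ {n} {L : LinearForm n} {g} x → L ∈ g → evalLinear L x ≈ 0# → evalGate g x ≈ 0#
  evalGate-vanishes x (here ≡.refl) L≈0 = trans (*-congʳ L≈0) (zeroˡ _)
  evalGate-vanishes x (there L∈g)   L≈0 = trans (*-congˡ (evalGate-vanishes x L∈g L≈0)) (zeroʳ _)

  _≟ₘ_ : ∀ {n} (m m′ : Monomial n) → Dec (m ≡ m′)
  _≟ₘ_ = Vec.≡-dec ℕ._≟_

  coeffAt : ∀ {n} → Monomial n → Carrier × Monomial n → Carrier
  coeffAt m (a , m′) = if does (m ≟ₘ m′) then a else 0#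

  coeff-∷ : ∀ {n} (m : Monomial n) t P → coeff m (t ∷ P) ≈ coeffAt m t + coeff m P
  coeff-∷ m (a , m′) P with m ≟ₘ m′
  ... | yes _ = refl
  ... | no  _ = sym (+-identityˡ _)

  module _ {n} (x : Vector Carrier n) where

    listSum-coeffAt-∉ : ∀ t (M : List (Monomial n)) → All (λ m → ¬ proj₂ t ≡ m) M →
                        listSum (λ m → coeffAt m t * evalMonomial m x) M ≈ 0#
    listSum-coeffAt-∉ t        []      []         = refl
    listSum-coeffAt-∉ (a , m′) (m ∷ M) (m′≢m ∷ ∉M) with m ≟ₘ m′
    ... | yes m≡m′ = contradiction (≡.sym m≡m′) m′≢m
    ... | no  _    = trans (+-cong (zeroˡ _) (listSum-coeffAt-∉ (a , m′) M ∉M)) (+-identityʳ _)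

    listSum-coeffAt-∈ : ∀ t (M : List (Monomial n)) → Unique M → proj₂ t ∈ M →
                        listSum (λ m → coeffAt m t * evalMonomial m x) M ≈ evalTerm t x
    listSum-coeffAt-∈ (a , m′) (m ∷ M) (∉M ∷ _) (here ≡.refl) with m ≟ₘ m
    ... | yes _   = trans (+-congˡ (listSum-coeffAt-∉ (a , m) M ∉M)) (+-identityʳ _)
    ... | no  m≢m = contradiction ≡.refl m≢m
    listSum-coeffAt-∈ (a , m′) (m ∷ M) (∉M ∷ !M) (there m′∈M) with m ≟ₘ m′
    ... | yes ≡.refl = contradiction ≡.refl (All.lookup ∉M m′∈M)
    ... | no  _      = trans (+-cong (zeroˡ _) (listSum-coeffAt-∈ (a , m′) M !M m′∈M)) (+-identityˡ _)

    eval-by-coeff : ∀ (M : List (Monomial n)) → Unique M → (P : Polynomial n) → All (λ t → proj₂ t ∈ M) P →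
                    eval P x ≈ listSum (λ m → coeff m P * evalMonomial m x) M
    eval-by-coeff M !M []      []         = sym (listSum-zero _ M (λ m → zeroˡ _))
    eval-by-coeff M !M (t ∷ P) (t∈M ∷ P⊆M) = begin
      evalTerm t x + eval P x
        ≈⟨ +-cong (listSum-coeffAt-∈ t M !M t∈M) (sym (eval-by-coeff M !M P P⊆M)) ⟨
      listSum (λ m → coeffAt m t * evalMonomial m x) M + listSum (λ m → coeff m P * evalMonomial m x) M
        ≈⟨ listSum-+ _ _ M ⟨
      listSum (λ m → coeffAt m t * evalMonomial m x + coeff m P * evalMonomial m x) M
        ≈⟨ listSum-cong M (λ m → trans (*-congʳ (coeff-∷ m t P)) (distribʳ _ _ _)) ⟨
      listSum (λ m → coeff m (t ∷ P) * evalMonomial m x) M ∎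

  eval-cong : ∀ {n} (P P′ : Polynomial n) → P ≈P P′ → ∀ x → eval P x ≈ eval P′ x
  eval-cong {n} P P′ P≈P′ x = begin
    eval P x
      ≈⟨ eval-by-coeff x M !M P (All.tabulate (λ t∈P → ∈-deduplicate⁺ _≟ₘ_ (∈-++⁺ˡ (∈-map⁺ proj₂ t∈P)))) ⟩
    listSum (λ m → coeff m P * evalMonomial m x) M
      ≈⟨ listSum-cong M (λ m → *-congʳ (P≈P′ m)) ⟩
    listSum (λ m → coeff m P′ * evalMonomial m x) M
      ≈⟨ eval-by-coeff x M !M P′
           (All.tabulate (λ t∈P′ → ∈-deduplicate⁺ _≟ₘ_ (∈-++⁺ʳ (map proj₂ P) (∈-map⁺ proj₂ t∈P′)))) ⟨
    eval P′ x ∎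
    where
    M = deduplicate _≟ₘ_ (map proj₂ P ++ map proj₂ P′)
    !M : Unique M
    !M = deduplicate-! _≟ₘ_ (map proj₂ P ++ map proj₂ P′)

  computes⇒evalCircuit≈S₂ : ∀ {n} (C : Circuit n) → Computes C (S2 n) → ∀ x → evalCircuit C x ≈ S₂ x
  computes⇒evalCircuit≈S₂ {n} C C≈S2 x =
    trans (sym (eval-circuitPoly C x)) (trans (eval-cong (circuitPoly C) (S2 n) C≈S2 x) (eval-S2 n x))

pivotToFree : ∀ {m t} → Fin (suc m) → (Fin (suc m) ⊎ Fin t) ↔ (Fin m ⊎ Fin (suc t))
pivotToFree {m} {t} k = mk↔ₛ′ to from to∘from from∘to
  where
  to : Fin (suc m) ⊎ Fin t → Fin m ⊎ Fin (suc t)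
  to (inj₁ j) with k Fin.≟ j
  ... | yes _   = inj₂ zero
  ... | no  k≢j = inj₁ (Fin.punchOut k≢j)
  to (inj₂ l) = inj₂ (suc l)

  from : Fin m ⊎ Fin (suc t) → Fin (suc m) ⊎ Fin t
  from (inj₁ j)       = inj₁ (punchIn k j)
  from (inj₂ zero)    = inj₁ k
  from (inj₂ (suc l)) = inj₂ l

  to∘from : ∀ u → to (from u) ≡ u
  to∘from (inj₁ j) with k Fin.≟ punchIn k j
  ... | yes k≡j = contradiction (≡.sym k≡j) (Fin.punchInᵢ≢i k j)
  ... | no  _   = ≡.cong inj₁ (≡.trans (Fin.punchOut-cong k ≡.refl) (Fin.punchOut-punchIn k))
  to∘from (inj₂ zero) with k Fin.≟ k
  ... | yes _   = ≡.refl
  ... | no  k≢k = contradiction ≡.refl k≢k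
  to∘from (inj₂ (suc l)) = ≡.refl

  from∘to : ∀ u → from (to u) ≡ u
  from∘to (inj₁ j) with k Fin.≟ j
  ... | yes k≡j = ≡.cong inj₁ k≡j
  ... | no  k≢j = ≡.cong inj₁ (Fin.punchIn-punchOut k≢j)
  from∘to (inj₂ l) = ≡.refl

module EchelonCharts {c ℓ} (R : CommutativeRing c ℓ) where
  open CommutativeRing R hiding (zero)
  open Sums R
  open ElementarySymmetric R
  open Poly R using (LinearForm)
  open PolynomialEvaluation R using (evalLinear; evalGate)
  open import Algebra.Properties.Group +-group using (x∙y⁻¹≈ε⇒x≈y)
  open import Relation.Binary.Reasoning.Setoid setoid

  -- The affine subspace { base ⊕ Σ_j y_j · column j } of Fⁿ, whose point with parameter y has
  -- coordinate y_j at pivot j.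
  record EchelonChart (n m : ℕ) : Set (c ⊔ ℓ) where
    field
      {codim}    : ℕ
      coords     : Fin n ↔ (Fin m ⊎ Fin codim)
      base       : Vector Carrier n
      dir        : Fin n → Fin m → Carrier
      base-pivot : ∀ j → base (Inverse.from coords (inj₁ j)) ≈ 0#
      dir-pivot  : ∀ j j′ → dir (Inverse.from coords (inj₁ j)) j′ ≈ δ j j′

    pivot : Fin m → Fin n
    pivot j = Inverse.from coords (inj₁ j)

    nonPivot : Fin codim → Fin n
    nonPivot l = Inverse.from coords (inj₂ l)

    column : Fin m → Vector Carrier n
    column j i = dir i j

    direction : Vector Carrier m → Vector Carrier n
    direction y i = ∑[ j < m ] (dir i j * y j)

    point : Vector Carrier m → Vector Carrier n
    point y = base ⊕ direction y

    reorder : Permutation (m ℕ.+ codim) n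
    reorder = ↔-trans Fin.+↔⊎ (↔-sym coords)

    dimension : m ℕ.+ codim ≡ n
    dimension = ↔⇒≡ reorder

    ∑-pivots : ∀ (f : Vector Carrier n) → ∑[ i < n ] f i ≈ ∑[ j < m ] f (pivot j) + ∑[ l < codim ] f (nonPivot l)
    ∑-pivots f = begin
      ∑[ i < n ] f i
        ≈⟨ ∑-permute f reorder ⟩
      ∑[ k < m ℕ.+ codim ] f (Inverse.from coords (Fin.splitAt m k))
        ≈⟨ ∑-↑ m codim (λ k → f (Inverse.from coords (Fin.splitAt m k))) ⟩
      ∑[ j < m ] f (Inverse.from coords (Fin.splitAt m (j ↑ˡ codim)))
        + ∑[ l < codim ] f (Inverse.from coords (Fin.splitAt m (m ↑ʳ l)))
        ≈⟨ +-cong (sum-cong-≋ (λ j → reflexive (≡.cong (λ u → f (Inverse.from coords u)) (Fin.splitAt-↑ˡ m j codim))))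
                  (sum-cong-≋ (λ l → reflexive (≡.cong (λ u → f (Inverse.from coords u)) (Fin.splitAt-↑ʳ m codim l)))) ⟩
      ∑[ j < m ] f (pivot j) + ∑[ l < codim ] f (nonPivot l) ∎

  identityChart : ∀ n → EchelonChart n n
  identityChart n = record
    { codim      = 0
    ; coords     = mk↔ₛ′ inj₁ [ (λ i → i) , (λ ()) ] (λ { (inj₁ _) → ≡.refl ; (inj₂ ()) }) (λ _ → ≡.refl)
    ; base       = λ _ → 0#
    ; dir        = δ
    ; base-pivot = λ _ → refl
    ; dir-pivot  = λ _ _ → refl
    }

  S₂-ConstantOn : ∀ {n m} → EchelonChart n m → Set (c ⊔ ℓ)
  S₂-ConstantOn E = ∃ λ cst → ∀ y → S₂ (EchelonChart.point E y) ≈ cst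

  module _ {n m} (E : EchelonChart n m) where
    open EchelonChart E

    direction-· : ∀ a y i → direction (a · y) i ≈ (a · direction y) i
    direction-· a y i = trans (sum-cong-≋ (λ j → x∙yz≈y∙xz (dir i j) a (y j))) (∑-*ˡ a (λ j → dir i j * y j))
      where open import Algebra.Properties.CommutativeSemigroup *-commutativeSemigroup using (x∙yz≈y∙xz)

    direction-⊕ : ∀ y y′ i → direction (y ⊕ y′) i ≈ (direction y ⊕ direction y′) i
    direction-⊕ y y′ i = trans (sum-cong-≋ (λ j → distribˡ (dir i j) (y j) (y′ j)))
                               (∑-distrib-+ (λ j → dir i j * y j) (λ j → dir i j * y′ j))

    direction-δ : ∀ j i → direction (λ j′ → δ j′ j) i ≈ column j i
    direction-δ j i = ∑-δ (dir i) j

    coeffOn : LinearForm n → Fin m → Carrier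
    coeffOn (a₀ , a) j = ∑[ i < n ] (a i * dir i j)

    evalLinear-point : ∀ L y → evalLinear L (point y) ≈ evalLinear L base + ∑[ j < m ] (coeffOn L j * y j)
    evalLinear-point (a₀ , a) y = begin
      a₀ + ∑[ i < n ] (a i * (base i + ∑[ j < m ] (dir i j * y j)))
        ≈⟨ +-congˡ (sum-cong-≋ (λ i → trans (distribˡ (a i) (base i) _)
             (+-congˡ (trans (sym (∑-*ˡ (a i) (λ j → dir i j * y j)))
                             (sum-cong-≋ (λ j → sym (*-assoc (a i) (dir i j) (y j)))))))) ⟩
      a₀ + ∑[ i < n ] (a i * base i + ∑[ j < m ] (a i * dir i j * y j))
        ≈⟨ +-congˡ (∑-distrib-+ (λ i → a i * base i) (λ i → ∑[ j < m ] (a i * dir i j * y j))) ⟩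
      a₀ + (∑[ i < n ] (a i * base i) + ∑[ i < n ] ∑[ j < m ] (a i * dir i j * y j))
        ≈⟨ +-congˡ (+-congˡ (∑-comm (λ i j → a i * dir i j * y j))) ⟩
      a₀ + (∑[ i < n ] (a i * base i) + ∑[ j < m ] ∑[ i < n ] (a i * dir i j * y j))
        ≈⟨ +-congˡ (+-congˡ (sum-cong-≋ (λ j → ∑-*ʳ (y j) (λ i → a i * dir i j)))) ⟩
      a₀ + (∑[ i < n ] (a i * base i) + ∑[ j < m ] (coeffOn (a₀ , a) j * y j))
        ≈⟨ +-assoc _ _ _ ⟨
      evalLinear (a₀ , a) base + ∑[ j < m ] (coeffOn (a₀ , a) j * y j) ∎

    ConstantOnChart : LinearForm n → Set ℓ
    ConstantOnChart L = ∀ j → coeffOn L j ≈ 0#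

    evalGate-constant : ∀ g → All ConstantOnChart g → ∀ y → evalGate g (point y) ≈ evalGate g base
    evalGate-constant []      []             y = refl
    evalGate-constant (L ∷ g) (L-const ∷ g-const) y = *-cong L-point≈L-base (evalGate-constant g g-const y)
      where
      L-point≈L-base : evalLinear L (point y) ≈ evalLinear L base
      L-point≈L-base = trans (evalLinear-point L y)
        (trans (+-congˡ (trans (sum-cong-≋ (λ j → trans (*-congʳ (L-const j)) (zeroˡ (y j)))) (sum-replicate-zero m))) (+-identityʳ _))

    S₁-column : ∀ j → S₁ (column j) ≈ 1# + ∑[ l < codim ] dir (nonPivot l) j
    S₁-column j = trans (∑-pivots (column j)) (+-congʳ (begin
      ∑[ j′ < m ] dir (pivot j′) j     ≈⟨ sum-cong-≋ (λ j′ → trans (dir-pivot j′ j) (sym (*-identityˡ _))) ⟩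
      ∑[ j′ < m ] (1# * δ j′ j)        ≈⟨ ∑-δ (λ _ → 1#) j ⟩
      1# ∎))

    module _ (½ : Carrier) (½*2≈1 : ½ * (1# + 1#) ≈ 1#) (cst : Carrier) (S₂-const : ∀ y → S₂ (point y) ≈ cst) where

      S₂-direction≈0 : ∀ y → S₂ (direction y) ≈ 0#
      S₂-direction≈0 y = invariant±⇒isotropic ½ ½*2≈1 base (direction y)
        (trans (S₂-const y) (sym S₂-base))
        (trans (S₂-cong (λ i → +-congˡ (sym (direction-· (- 1#) y i)))) (trans (S₂-const ((- 1#) · y)) (sym S₂-base)))
        where
        S₂-base : S₂ base ≈ cst
        S₂-base = trans (S₂-cong (λ i → sym (trans (+-congˡ (trans (sum-cong-≋ (λ j → zeroʳ (dir i j))) (sum-replicate-zero m)))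
                                                   (+-identityʳ (base i)))))
                        (S₂-const (λ _ → 0#))

      S₂-column≈0 : ∀ j → S₂ (column j) ≈ 0#
      S₂-column≈0 j = trans (S₂-cong (λ i → sym (direction-δ j i))) (S₂-direction≈0 (λ j′ → δ j′ j))

      polar-columns≈0 : ∀ i j → polar (column i) (column j) ≈ 0#
      polar-columns≈0 i j = isotropic⇒polar≈0 (column i) (column j) (S₂-column≈0 i) (S₂-column≈0 j)
        (trans (S₂-cong (λ k → sym (trans (direction-⊕ (λ j′ → δ j′ i) (λ j′ → δ j′ j) k)
                                          (+-cong (direction-δ i k) (direction-δ j k)))))
               (S₂-direction≈0 ((λ j′ → δ j′ i) ⊕ (λ j′ → δ j′ j))))

      gram : ∀ i j → S₁ (column i) * S₁ (column j) ≈ δ i j + ∑[ l < codim ] (dir (nonPivot l) i * dir (nonPivot l) j)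
      gram i j = trans (x∙y⁻¹≈ε⇒x≈y _ _ (polar-columns≈0 i j)) (trans (∑-pivots (λ k → dir k i * dir k j)) (+-congʳ (begin
        ∑[ j′ < m ] (dir (pivot j′) i * dir (pivot j′) j)  ≈⟨ sum-cong-≋ (λ j′ → *-cong (dir-pivot j′ i) (dir-pivot j′ j)) ⟩
        ∑[ j′ < m ] (δ j′ i * δ j′ j)                      ≈⟨ ∑-δ (λ j′ → δ j′ i) j ⟩
        δ j i                                               ≈⟨ δ-sym j i ⟩
        δ i j ∎)))

record IsDiscreteField {c ℓ} (R : CommutativeRing c ℓ) : Set (c ⊔ ℓ) where
  open CommutativeRing R
  field
    1≉0     : ¬ 1# ≈ 0#
    inverse : ∀ x → ¬ x ≈ 0# → ∃ λ y → x * y ≈ 1#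
    _≟_     : Decidable _≈_

module DiscreteField {c ℓ} (R : CommutativeRing c ℓ) (isDiscreteField : IsDiscreteField R) where
  open CommutativeRing R hiding (zero)
  open IsDiscreteField isDiscreteField

  open IntegerCoefficients R using (fromℕ; solve; _:=_; _:+_; _:*_; :-_; _:-_; con)
  open Sums R
  open ElementarySymmetric R
  open EchelonCharts R
  open Poly R using (LinearForm; Circuit)
  open import Algebra.Properties.Semiring.Mult.TCOptimised semiring using (×1-homo-*; 1+×)
  open PolynomialEvaluation R using (evalLinear; evalGate; evalCircuit; evalCircuit-cong; evalGate-vanishes)
  open import Algebra.Properties.Ring ring using (-0#≈0#)
  open import Algebra.Properties.Group +-group using (x≈y⇒x∙y⁻¹≈ε)
  open import Relation.Binary.Reasoning.Setoid setoid

  x≉0∧y≉0⇒x*y≉0 : ∀ {x y} → ¬ x ≈ 0# → ¬ y ≈ 0# → ¬ x * y ≈ 0#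
  x≉0∧y≉0⇒x*y≉0 {x} {y} x≉0 y≉0 xy≈0 = y≉0 (begin
    y                  ≈⟨ *-identityˡ y ⟨
    1# * y             ≈⟨ *-congʳ (proj₂ (inverse x x≉0)) ⟨
    x * x⁻¹ * y        ≈⟨ *-congʳ (*-comm x x⁻¹) ⟩
    x⁻¹ * x * y        ≈⟨ *-assoc x⁻¹ x y ⟩
    x⁻¹ * (x * y)      ≈⟨ *-congˡ xy≈0 ⟩
    x⁻¹ * 0#           ≈⟨ zeroʳ x⁻¹ ⟩
    0# ∎)
    where x⁻¹ = proj₁ (inverse x x≉0)

  fromℕ-^≉0 : ∀ {a} → ¬ fromℕ a ≈ 0# → ∀ r → ¬ fromℕ (a ℕ.^ r) ≈ 0#
  fromℕ-^≉0 a≉0 zero    = 1≉0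
  fromℕ-^≉0 {a} a≉0 (suc r) aʳ⁺¹≈0 =
    x≉0∧y≉0⇒x*y≉0 a≉0 (fromℕ-^≉0 a≉0 r) (trans (sym (×1-homo-* a (a ℕ.^ r))) aʳ⁺¹≈0)

  1+ab≡cd⇒¬[b≈0∧d≈0] : ∀ a b c d → suc (a ℕ.* b) ≡ c ℕ.* d → fromℕ b ≈ 0# → ¬ fromℕ d ≈ 0#
  1+ab≡cd⇒¬[b≈0∧d≈0] a b c d eq b≈0 d≈0 = 1≉0 (begin
    1#                         ≈⟨ +-identityʳ 1# ⟨
    1# + 0#                    ≈⟨ +-congˡ (trans (*-congˡ b≈0) (zeroʳ _)) ⟨
    1# + fromℕ a * fromℕ b     ≈⟨ +-congˡ (×1-homo-* a b) ⟨
    1# + fromℕ (a ℕ.* b)       ≈⟨ 1+× (a ℕ.* b) 1# ⟨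
    fromℕ (suc (a ℕ.* b))      ≡⟨ ≡.cong fromℕ eq ⟩
    fromℕ (c ℕ.* d)            ≈⟨ ×1-homo-* c d ⟩
    fromℕ c * fromℕ d          ≈⟨ *-congˡ d≈0 ⟩
    fromℕ c * 0#               ≈⟨ zeroʳ _ ⟩
    0# ∎)

  module _ {p} (p-prime : Prime p) (r : ℕ) (fromℕ-pʳ≈0 : fromℕ (p ℕ.^ r) ≈ 0#) where

    fromℕ-p≈0 : fromℕ p ≈ 0#
    fromℕ-p≈0 = decidable-stable (fromℕ p ≟ 0#) (λ p≉0 → fromℕ-^≉0 p≉0 r fromℕ-pʳ≈0)

    ∤⇒fromℕ-invertible : ∀ {k} → ¬ p ∣ k → ∃ λ u → u * fromℕ k ≈ 1#
    ∤⇒fromℕ-invertible {k} p∤k = proj₁ (inverse (fromℕ k) k≉0) , trans (*-comm _ _) (proj₂ (inverse (fromℕ k) k≉0))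
      where
      coprime : Coprime p k
      coprime (d∣p , d∣k) with prime⇒irreducible p-prime d∣p
      ... | inj₁ d≡1 = d≡1
      ... | inj₂ ≡.refl = contradiction d∣k p∤k
      k≉0 : ¬ fromℕ k ≈ 0#
      k≉0 k≈0 with coprime-Bézout coprime
      ... | Bézout.+- x y eq = 1+ab≡cd⇒¬[b≈0∧d≈0] y k x p eq k≈0 fromℕ-p≈0
      ... | Bézout.-+ x y eq = 1+ab≡cd⇒¬[b≈0∧d≈0] x p y k eq fromℕ-p≈0 k≈0

  Matrix : ℕ → ℕ → Set c
  Matrix f k = Fin f → Fin k → Carrier

  _·ᴹ_≈I : ∀ {f k} → Matrix f k → Matrix k f → Set ℓ
  _·ᴹ_≈I {f} {k} A B = ∀ i j → ∑[ l < k ] (A i l * B l j) ≈ δ i j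

  -- Gaussian elimination on the first column of A.
  ·ᴹ≈I⇒≤ : ∀ {f k} (A : Matrix f k) (B : Matrix k f) → A ·ᴹ B ≈I → f ≤ k
  ·ᴹ≈I⇒≤ {zero}  {k}     A B AB≈I = z≤n
  ·ᴹ≈I⇒≤ {suc f} {zero}  A B AB≈I = contradiction (trans (sym (δ-diag {suc f} zero)) (sym (AB≈I zero zero))) 1≉0
  ·ᴹ≈I⇒≤ {suc f} {suc k} A B AB≈I with Fin.any? (λ i → ¬? (A i zero ≟ 0#))
  ... | no  column₀≈0     = ℕ.m≤n⇒m≤1+n (·ᴹ≈I⇒≤ (λ i l → A i (suc l)) (λ l j → B (suc l) j) A′B′≈I)
    where
    A′B′≈I : (λ i l → A i (suc l)) ·ᴹ (λ l j → B (suc l) j) ≈I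
    A′B′≈I i j = begin
      ∑[ l < k ] (A i (suc l) * B (suc l) j)           ≈⟨ +-identityˡ _ ⟨
      0# + ∑[ l < k ] (A i (suc l) * B (suc l) j)      ≈⟨ +-congʳ (trans (*-congʳ (A₀≈0 i)) (zeroˡ _)) ⟨
      A i zero * B zero j + _                          ≈⟨ AB≈I i j ⟩
      δ i j ∎
      where
      A₀≈0 : ∀ i → A i zero ≈ 0#
      A₀≈0 i = decidable-stable (A i zero ≟ 0#) (λ A₀≉0 → column₀≈0 (i , A₀≉0))
  ... | yes (r , pivot≉0) = s≤s (·ᴹ≈I⇒≤ A′ B′ A′B′≈I)
    where
    pivot⁻¹ = proj₁ (inverse (A r zero) pivot≉0)
    A′ : Matrix f k
    A′ i l = A (punchIn r i) (suc l) - A (punchIn r i) zero * pivot⁻¹ * A r (suc l)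
    B′ : Matrix k f
    B′ l j = B (suc l) (punchIn r j)
    rest : ∀ i j → ∑[ l < k ] (A i (suc l) * B (suc l) j) ≈ δ i j - A i zero * B zero j
    rest i j = begin
      ∑[ l < k ] (A i (suc l) * B (suc l) j)
        ≈⟨ solve 2 (λ s x → s := (x :+ s) :- x) refl _ (A i zero * B zero j) ⟩
      (A i zero * B zero j + ∑[ l < k ] (A i (suc l) * B (suc l) j)) - A i zero * B zero j
        ≈⟨ +-congʳ (AB≈I i j) ⟩
      δ i j - A i zero * B zero j ∎
    A′B′≈I : A′ ·ᴹ B′ ≈I
    A′B′≈I i j = begin
      ∑[ l < k ] (A′ i l * B′ l j)
        ≈⟨ sum-cong-≋ (λ l → solve 4 (λ a b u v → (a :- u :* b) :* v := a :* v :- u :* (b :* v))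
                                       refl (A i′ (suc l)) (A r (suc l)) (A i′ zero * pivot⁻¹) (B (suc l) j′)) ⟩
      ∑[ l < k ] (A i′ (suc l) * B (suc l) j′ - A i′ zero * pivot⁻¹ * (A r (suc l) * B (suc l) j′))
        ≈⟨ ∑-linear (λ l → A i′ (suc l) * B (suc l) j′) (λ l → A r (suc l) * B (suc l) j′) _ ⟩
      ∑[ l < k ] (A i′ (suc l) * B (suc l) j′) - A i′ zero * pivot⁻¹ * ∑[ l < k ] (A r (suc l) * B (suc l) j′)
        ≈⟨ +-cong (rest i′ j′)
                  (-‿cong (*-congˡ (trans (rest r j′) (+-congʳ (δ-off (λ r≡j′ → Fin.punchInᵢ≢i r j (≡.sym r≡j′))))))) ⟩
      (δ i′ j′ - A i′ zero * B zero j′) - A i′ zero * pivot⁻¹ * (0# - A r zero * B zero j′)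
        ≈⟨ solve 5 (λ d a b p q → (d :- a :* b) :- a :* q :* (con (+ 0) :- p :* b) := d :+ a :* b :* (p :* q :- con (+ 1)))
                 refl (δ i′ j′) (A i′ zero) (B zero j′) (A r zero) pivot⁻¹ ⟩
      δ i′ j′ + A i′ zero * B zero j′ * (A r zero * pivot⁻¹ - 1#)
        ≈⟨ +-congˡ (*-congˡ (trans (+-congʳ (proj₂ (inverse (A r zero) pivot≉0))) (-‿inverseʳ 1#))) ⟩
      δ i′ j′ + A i′ zero * B zero j′ * 0#
        ≈⟨ trans (+-congˡ (zeroʳ _)) (+-identityʳ _) ⟩
      δ i′ j′
        ≈⟨ δ-punchIn r i j ⟩
      δ i j ∎
      where
      i′ = punchIn r i
      j′ = punchIn r j

  module _ {m t} (S : Vector Carrier m) (a : Matrix t m) where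

    private
      P : Matrix m m
      P i j = ∑[ l < t ] (a l i * a l j)

    gram⇒≤1+ : (∀ i j → S i * S j ≈ δ i j + P i j) → m ≤ suc t
    gram⇒≤1+ gram = ·ᴹ≈I⇒≤ A B AB≈I
      where
      A : Matrix m (suc t)
      A i zero    = S i
      A i (suc l) = a l i
      B : Matrix (suc t) m
      B zero    j = S j
      B (suc l) j = - a l j
      AB≈I : A ·ᴹ B ≈I
      AB≈I i j = begin
        S i * S j + ∑[ l < t ] (a l i * - a l j)
          ≈⟨ +-cong (gram i j) (sum-cong-≋ (λ l → sym (-‿distribʳ-* (a l i) (a l j)))) ⟩
        δ i j + P i j + ∑[ l < t ] (- (a l i * a l j))
          ≈⟨ +-congˡ (∑-neg (λ l → a l i * a l j)) ⟩
        δ i j + P i j - P i j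
          ≈⟨ solve 2 (λ d p → d :+ p :- p := d) refl (δ i j) (P i j) ⟩
        δ i j ∎
        where open import Algebra.Properties.Ring ring using (-‿distribʳ-*)

    gram⇒≤ : (∀ i j → S i * S j ≈ δ i j + P i j) → (∀ j → S j ≈ 1# + ∑[ l < t ] a l j) →
             ∀ u → u * (fromℕ (m ℕ.+ t) - 1#) ≈ 1# → m ≤ t
    -- By the Gram identity, Σ_l (1 − colSum l) · T l j = (m + t − 1) · S j, which u cancels.
    gram⇒≤ gram S≈1+∑a u u-inverse = ·ᴹ≈I⇒≤ H T HT≈I
      where
      colSum : Fin t → Carrier
      colSum l = ∑[ i < m ] a l i
      T : Matrix t m
      T l j = S j - a l j
      H : Matrix m t
      H i l = u * (1# - colSum l) + a l i

      ∑a≈S-1 : ∀ j → ∑[ l < t ] a l j ≈ S j - 1#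
      ∑a≈S-1 j = begin
        ∑[ l < t ] a l j                  ≈⟨ solve 1 (λ x → x := con (+ 1) :+ x :- con (+ 1)) refl _ ⟩
        1# + ∑[ l < t ] a l j - 1#        ≈⟨ +-congʳ (S≈1+∑a j) ⟨
        S j - 1# ∎

      ∑aT : ∀ i j → ∑[ l < t ] (a l i * T l j) ≈ δ i j - S j
      ∑aT i j = begin
        ∑[ l < t ] (a l i * (S j - a l j))
          ≈⟨ sum-cong-≋ (λ l → solve 3 (λ x s y → x :* (s :- y) := x :* s :- con (+ 1) :* (x :* y)) refl (a l i) (S j) (a l j)) ⟩
        ∑[ l < t ] (a l i * S j - 1# * (a l i * a l j))
          ≈⟨ ∑-linear (λ l → a l i * S j) (λ l → a l i * a l j) 1# ⟩
        ∑[ l < t ] (a l i * S j) - 1# * P i j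
          ≈⟨ +-cong (trans (∑-*ʳ (S j) (λ l → a l i)) (*-congʳ (∑a≈S-1 i))) (-‿cong (*-identityˡ _)) ⟩
        (S i - 1#) * S j - P i j
          ≈⟨ solve 3 (λ s r p → (s :- con (+ 1)) :* r :- p := s :* r :- p :- r) refl (S i) (S j) (P i j) ⟩
        S i * S j - P i j - S j
          ≈⟨ +-congʳ (+-congʳ (gram i j)) ⟩
        δ i j + P i j - P i j - S j
          ≈⟨ solve 3 (λ d p s → d :+ p :- p :- s := d :- s) refl (δ i j) (P i j) (S j) ⟩
        δ i j - S j ∎

      ∑T : ∀ j → ∑[ l < t ] T l j ≈ fromℕ t * S j - (S j - 1#)
      ∑T j = begin
        ∑[ l < t ] (S j - a l j)
          ≈⟨ sum-cong-≋ (λ l → +-congˡ (-‿cong (*-identityˡ (a l j)))) ⟨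
        ∑[ l < t ] (S j - 1# * a l j)
          ≈⟨ ∑-linear (λ _ → S j) (λ l → a l j) 1# ⟩
        ∑[ l < t ] S j - 1# * ∑[ l < t ] a l j
          ≈⟨ +-cong (∑-const t (S j)) (-‿cong (trans (*-identityˡ _) (∑a≈S-1 j))) ⟩
        fromℕ t * S j - (S j - 1#) ∎

      ∑colSumT : ∀ j → ∑[ l < t ] (colSum l * T l j) ≈ 1# - fromℕ m * S j
      ∑colSumT j = begin
        ∑[ l < t ] (colSum l * T l j)
          ≈⟨ sum-cong-≋ (λ l → ∑-*ʳ (T l j) (a l)) ⟨
        ∑[ l < t ] ∑[ i < m ] (a l i * T l j)
          ≈⟨ ∑-comm (λ l i → a l i * T l j) ⟩
        ∑[ i < m ] ∑[ l < t ] (a l i * T l j)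
          ≈⟨ sum-cong-≋ (λ i → trans (∑aT i j) (+-congˡ (-‿cong (sym (*-identityˡ (S j)))))) ⟩
        ∑[ i < m ] (δ i j - 1# * S j)
          ≈⟨ ∑-linear (λ i → δ i j) (λ _ → S j) 1# ⟩
        ∑[ i < m ] δ i j - 1# * ∑[ i < m ] S j
          ≈⟨ +-cong (trans (sum-cong-≋ (λ i → sym (*-identityˡ (δ i j)))) (∑-δ (λ _ → 1#) j))
                    (-‿cong (trans (*-identityˡ _) (∑-const m (S j)))) ⟩
        1# - fromℕ m * S j ∎

      ∑[1-colSum]T : ∀ j → ∑[ l < t ] ((1# - colSum l) * T l j) ≈ (fromℕ (m ℕ.+ t) - 1#) * S j
      ∑[1-colSum]T j = begin
        ∑[ l < t ] ((1# - colSum l) * T l j)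
          ≈⟨ sum-cong-≋ (λ l → solve 2 (λ c x → (con (+ 1) :- c) :* x := x :- con (+ 1) :* (c :* x)) refl (colSum l) (T l j)) ⟩
        ∑[ l < t ] (T l j - 1# * (colSum l * T l j))
          ≈⟨ ∑-linear (λ l → T l j) (λ l → colSum l * T l j) 1# ⟩
        ∑[ l < t ] T l j - 1# * ∑[ l < t ] (colSum l * T l j)
          ≈⟨ +-cong (∑T j) (-‿cong (*-congˡ (∑colSumT j))) ⟩
        (fromℕ t * S j - (S j - 1#)) - 1# * (1# - fromℕ m * S j)
          ≈⟨ solve 3 (λ a b s → (b :* s :- (s :- con (+ 1))) :- con (+ 1) :* (con (+ 1) :- a :* s) := (a :+ b :- con (+ 1)) :* s)
                   refl (fromℕ m) (fromℕ t) (S j) ⟩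
        (fromℕ m + fromℕ t - 1#) * S j
          ≈⟨ *-congʳ (+-congʳ (×-homo-+ 1# m t)) ⟨
        (fromℕ (m ℕ.+ t) - 1#) * S j ∎
        where open import Algebra.Properties.Semiring.Mult.TCOptimised semiring using (×-homo-+)

      HT≈I : H ·ᴹ T ≈I
      HT≈I i j = begin
        ∑[ l < t ] ((u * (1# - colSum l) + a l i) * T l j)
          ≈⟨ sum-cong-≋ (λ l → trans (distribʳ (T l j) (u * (1# - colSum l)) (a l i))
                                     (+-congʳ (*-assoc u (1# - colSum l) (T l j)))) ⟩
        ∑[ l < t ] (u * ((1# - colSum l) * T l j) + a l i * T l j)
          ≈⟨ ∑-distrib-+ (λ l → u * ((1# - colSum l) * T l j)) (λ l → a l i * T l j) ⟩
        ∑[ l < t ] (u * ((1# - colSum l) * T l j)) + ∑[ l < t ] (a l i * T l j)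
          ≈⟨ +-cong (trans (∑-*ˡ u (λ l → (1# - colSum l) * T l j)) (*-congˡ (∑[1-colSum]T j))) (∑aT i j) ⟩
        u * ((fromℕ (m ℕ.+ t) - 1#) * S j) + (δ i j - S j)
          ≈⟨ +-congʳ (trans (sym (*-assoc _ _ _)) (*-congʳ u-inverse)) ⟩
        1# * S j + (δ i j - S j)
          ≈⟨ solve 2 (λ s d → con (+ 1) :* s :+ (d :- s) := d) refl (S j) (δ i j) ⟩
        δ i j ∎

  module _ {n m} (E : EchelonChart n m) (½ : Carrier) (½*2≈1 : ½ * (1# + 1#) ≈ 1#)
           (cst : Carrier) (S₂-const : ∀ y → S₂ (EchelonChart.point E y) ≈ cst) where
    open EchelonChart E

    S₂-constant⇒dim≤1+codim : m ≤ suc codim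
    S₂-constant⇒dim≤1+codim = gram⇒≤1+ (λ j → S₁ (column j)) (λ l j → dir (nonPivot l) j) (gram E ½ ½*2≈1 cst S₂-const)

    S₂-constant⇒dim≤codim : ∀ u → u * (fromℕ n - 1#) ≈ 1# → m ≤ codim
    S₂-constant⇒dim≤codim u u-inverse =
      gram⇒≤ (λ j → S₁ (column j)) (λ l j → dir (nonPivot l) j) (gram E ½ ½*2≈1 cst S₂-const) (S₁-column E) u
             (trans (*-congˡ (+-congʳ (reflexive (≡.cong fromℕ dimension)))) u-inverse)

  constantOnChart? : ∀ {n m} (E : EchelonChart n m) L → ConstantOnChart E L ⊎ ∃ λ j → ¬ coeffOn E L j ≈ 0#
  constantOnChart? E L with Fin.any? (λ j → ¬? (coeffOn E L j ≟ 0#))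
  ... | yes nonzero  = inj₂ nonzero
  ... | no  ¬nonzero = inj₁ λ j → decidable-stable (coeffOn E L j ≟ 0#) (λ c≉0 → ¬nonzero (j , c≉0))

  constantGate? : ∀ {n m} (E : EchelonChart n m) g →
                  All (ConstantOnChart E) g ⊎ ∃ λ L → L ∈ g × ∃ λ j → ¬ coeffOn E L j ≈ 0#
  constantGate? E []      = inj₁ []
  constantGate? E (L ∷ g) with constantOnChart? E L | constantGate? E g
  ... | inj₂ L-nonconst | _                             = inj₂ (L , here ≡.refl , L-nonconst)
  ... | inj₁ L-const    | inj₁ g-const                  = inj₁ (L-const ∷ g-const)
  ... | inj₁ _          | inj₂ (L′ , L′∈g , L′-nonconst) = inj₂ (L′ , there L′∈g , L′-nonconst)

  -- Cutting by the hyperplane L = 0: the pivot coordinate k is solved for and becomes free.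
  module Cut {n m} (E : EchelonChart n (suc m)) (L : LinearForm n) (k : Fin (suc m))
             (cₖ≉0 : ¬ coeffOn E L k ≈ 0#) where
    open EchelonChart E

    private
      cₖ = coeffOn E L k
      cₖ⁻¹ = proj₁ (inverse cₖ cₖ≉0)
      c′ : Fin m → Carrier
      c′ j = coeffOn E L (punchIn k j)

    solveFor : Vector Carrier m → Carrier
    solveFor y′ = - (evalLinear L base + ∑[ j < m ] (c′ j * y′ j)) * cₖ⁻¹

    lift : Vector Carrier m → Vector Carrier (suc m)
    lift y′ = insertAt y′ k (solveFor y′)

    ∑-lift : ∀ (f : Fin (suc m) → Carrier) y′ →
             ∑[ j < suc m ] (f j * lift y′ j) ≈ f k * solveFor y′ + ∑[ j < m ] (f (punchIn k j) * y′ j)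
    ∑-lift f y′ = trans (sum-remove {i = k} (λ j → f j * lift y′ j))
      (+-cong (*-congˡ (reflexive (Vector.insertAt-lookup y′ k (solveFor y′))))
              (sum-cong-≋ (λ j → *-congˡ (reflexive (Vector.insertAt-punchIn y′ k (solveFor y′) j)))))

    L-lift≈0 : ∀ y′ → evalLinear L (point (lift y′)) ≈ 0#
    L-lift≈0 y′ = begin
      evalLinear L (point (lift y′))
        ≈⟨ evalLinear-point E L (lift y′) ⟩
      evalLinear L base + ∑[ j < suc m ] (coeffOn E L j * lift y′ j)
        ≈⟨ +-congˡ (∑-lift (coeffOn E L) y′) ⟩
      b + (cₖ * solveFor y′ + s)
        ≈⟨ solve 4 (λ b c i s → b :+ (c :* (:- (b :+ s) :* i) :+ s) := (b :+ s) :* (con (+ 1) :- c :* i)) refl b cₖ cₖ⁻¹ s ⟩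
      (b + s) * (1# - cₖ * cₖ⁻¹)
        ≈⟨ *-congˡ (x≈y⇒x∙y⁻¹≈ε (sym (proj₂ (inverse cₖ cₖ≉0)))) ⟩
      (b + s) * 0#
        ≈⟨ zeroʳ _ ⟩
      0# ∎
      where
      b = evalLinear L base
      s = ∑[ j < m ] (c′ j * y′ j)

    chart : EchelonChart n m
    chart = record
      { coords     = ↔-trans coords (pivotToFree k)
      ; base       = λ i → base i + dir i k * (- (evalLinear L base * cₖ⁻¹))
      ; dir        = λ i j → dir i (punchIn k j) - dir i k * (c′ j * cₖ⁻¹)
      ; base-pivot = λ j → trans (+-cong (base-pivot (punchIn k j)) (dir-pivot-k≈0 j (- (evalLinear L base * cₖ⁻¹))))
                                 (+-identityʳ 0#)
      ; dir-pivot  = λ j j′ → trans (+-cong (trans (dir-pivot (punchIn k j) (punchIn k j′)) (δ-punchIn k j j′))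
                                            (trans (-‿cong (dir-pivot-k≈0 j (c′ j′ * cₖ⁻¹))) -0#≈0#))
                                    (+-identityʳ _)
      }
      where
      dir-pivot-k≈0 : ∀ j x → dir (pivot (punchIn k j)) k * x ≈ 0#
      dir-pivot-k≈0 j x = trans (*-congʳ (trans (dir-pivot (punchIn k j) k) (δ-punchIn-pivot k j))) (zeroˡ x)

    point-chart : ∀ y′ i → EchelonChart.point chart y′ i ≈ point (lift y′) i
    point-chart y′ i = begin
      (base i + dᵏ * (- (b * cₖ⁻¹))) + ∑[ j < m ] ((dir i (punchIn k j) - dᵏ * (c′ j * cₖ⁻¹)) * y′ j)
        ≈⟨ +-congˡ (sum-cong-≋ (λ j → solve 5 (λ a d c i y → (a :- d :* (c :* i)) :* y := a :* y :- (d :* i) :* (c :* y))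
                                                refl (dir i (punchIn k j)) dᵏ (c′ j) cₖ⁻¹ (y′ j))) ⟩
      (base i + dᵏ * (- (b * cₖ⁻¹))) + ∑[ j < m ] (dir i (punchIn k j) * y′ j - (dᵏ * cₖ⁻¹) * (c′ j * y′ j))
        ≈⟨ +-congˡ (∑-linear (λ j → dir i (punchIn k j) * y′ j) (λ j → c′ j * y′ j) (dᵏ * cₖ⁻¹)) ⟩
      (base i + dᵏ * (- (b * cₖ⁻¹))) + (s′ - (dᵏ * cₖ⁻¹) * s)
        ≈⟨ solve 6 (λ v d b i s s′ → (v :+ d :* (:- (b :* i))) :+ (s′ :- (d :* i) :* s) := v :+ (d :* (:- (b :+ s) :* i) :+ s′))
                 refl (base i) dᵏ b cₖ⁻¹ s s′ ⟩
      base i + (dᵏ * solveFor y′ + s′)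
        ≈⟨ +-congˡ (∑-lift (dir i) y′) ⟨
      point (lift y′) i ∎
      where
      dᵏ = dir i k
      b = evalLinear L base
      s = ∑[ j < m ] (c′ j * y′ j)
      s′ = ∑[ j < m ] (dir i (punchIn k j) * y′ j)

  S₂≈_+⟦_⟧on_ : ∀ {n m} → Carrier → Circuit n → EchelonChart n m → Set (c ⊔ ℓ)
  S₂≈ cst +⟦ C ⟧on E = ∀ y → S₂ (EchelonChart.point E y) ≈ cst + evalCircuit C (EchelonChart.point E y)

  Restriction : ℕ → ℕ → ℕ → Set (c ⊔ ℓ)
  Restriction n m s = ∃₂ λ m′ (E′ : EchelonChart n m′) → m ≤ m′ ℕ.+ s × S₂-ConstantOn E′

  absorbConstantGate : ∀ {n m} (E : EchelonChart n m) g C cst → All (ConstantOnChart E) g →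
    S₂≈ cst +⟦ g ∷ C ⟧on E → S₂≈ cst + evalGate g (EchelonChart.base E) +⟦ C ⟧on E
  absorbConstantGate E g C cst g-const S₂≈ y =
    trans (S₂≈ y) (trans (+-congˡ (+-congʳ (evalGate-constant E g g-const y))) (sym (+-assoc _ _ _)))

  cutVanishingGate : ∀ {n m} (E : EchelonChart n (suc m)) {L k} (cₖ≉0 : ¬ coeffOn E L k ≈ 0#) g C cst → L ∈ g →
    S₂≈ cst +⟦ g ∷ C ⟧on E → S₂≈ cst +⟦ C ⟧on Cut.chart E L k cₖ≉0
  cutVanishingGate E {L} {k} cₖ≉0 g C cst L∈g S₂≈ y′ = begin
    S₂ (EchelonChart.point chart y′)
      ≈⟨ S₂-cong (point-chart y′) ⟩
    S₂ (point (lift y′))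
      ≈⟨ S₂≈ (lift y′) ⟩
    cst + (evalGate g (point (lift y′)) + evalCircuit C (point (lift y′)))
      ≈⟨ +-congˡ (trans (+-congʳ (evalGate-vanishes (point (lift y′)) L∈g (L-lift≈0 y′))) (+-identityˡ _)) ⟩
    cst + evalCircuit C (point (lift y′))
      ≈⟨ +-congˡ (evalCircuit-cong C (λ i → sym (point-chart y′ i))) ⟩
    cst + evalCircuit C (EchelonChart.point chart y′) ∎
    where
    open EchelonChart E
    open Cut E L k cₖ≉0

  eliminateGates : ∀ {n m} (C : Circuit n) (E : EchelonChart n m) cst → S₂≈ cst +⟦ C ⟧on E → Restriction n m (length C)
  eliminateGates {m = m} [] E cst S₂≈ =
    m , E , ℕ.≤-reflexive (≡.sym (ℕ.+-identityʳ m)) , cst , λ y → trans (S₂≈ y) (+-identityʳ cst)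
  eliminateGates {m = m} (g ∷ C) E cst S₂≈ with constantGate? E g
  ... | inj₁ g-const =
    let (m′ , E′ , m≤m′+C , S₂-const) =
          eliminateGates C E _ (absorbConstantGate E g C cst g-const S₂≈)
    in m′ , E′ , ℕ.≤-trans m≤m′+C (ℕ.+-monoʳ-≤ m′ (ℕ.n≤1+n _)) , S₂-const
  eliminateGates {m = suc m} (g ∷ C) E cst S₂≈ | inj₂ (L , L∈g , k , cₖ≉0) =
    let (m′ , E′ , m≤m′+C , S₂-const) =
          eliminateGates C (Cut.chart E L k cₖ≉0) cst (cutVanishingGate E cₖ≉0 g C cst L∈g S₂≈)
    in m′ , E′ , ℕ.≤-trans (s≤s m≤m′+C) (ℕ.≤-reflexive (≡.sym (ℕ.+-suc m′ _))) , S₂-const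

  module _ (½ : Carrier) (½*2≈1 : ½ * (1# + 1#) ≈ 1#) {n} (C : Circuit n) (C≈S₂ : ∀ x → evalCircuit C x ≈ S₂ x) where

    private
      restricted : Restriction n n (length C)
      restricted = eliminateGates C (identityChart n) 0#
        (λ y → trans (sym (C≈S₂ (EchelonChart.point (identityChart n) y))) (sym (+-identityˡ _)))

    circuit⇒n≤1+2s : n ≤ suc (length C ℕ.+ length C)
    circuit⇒n≤1+2s =
      let (_ , E , n≤m+C , cst , S₂-const) = restricted
      in dimension-count n≤m+C (S₂-constant⇒dim≤1+codim E ½ ½*2≈1 cst S₂-const) (EchelonChart.dimension E)

    circuit⇒n≤2s : ∀ u → u * (fromℕ n - 1#) ≈ 1# → n ≤ length C ℕ.+ length C
    circuit⇒n≤2s u u-inverse =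
      let (_ , E , n≤m+C , cst , S₂-const) = restricted
      in dimension-count n≤m+C (S₂-constant⇒dim≤codim E ½ ½*2≈1 cst S₂-const u u-inverse) (EchelonChart.dimension E)

module FiniteField {c ℓ} (R : CommutativeRing c ℓ) {q} (G : IsGF q R) where
  open CommutativeRing R hiding (zero)
  open IsGF G
  open IntegerCoefficients R using (fromℕ)
  open Sums R
  open import Algebra.Properties.Group +-group using (identityʳ-unique)
  open import Relation.Binary.Reasoning.Setoid setoid

  _≟_ : Decidable _≈_
  x ≟ y with enum-surj x | enum-surj y
  ... | i , enum-i≈x | j , enum-j≈y with i Fin.≟ j
  ... | yes ≡.refl = yes (trans (sym enum-i≈x) enum-j≈y)
  ... | no  i≢j    = no (λ x≈y → i≢j (enum-inj i j (trans enum-i≈x (trans x≈y (sym enum-j≈y)))))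

  isDiscreteField : IsDiscreteField R
  isDiscreteField = record { 1≉0 = nontrivial ; inverse = inverse ; _≟_ = _≟_ }

  fromℕ-q≈0 : fromℕ q ≈ 0#
  -- Translation by 1 permutes F, so Σ x = Σ (x + 1) = Σ x + q.
  fromℕ-q≈0 = identityʳ-unique (∑[ i < q ] enum i) (fromℕ q) (sym (begin
    ∑[ i < q ] enum i                     ≈⟨ ∑-permute enum translate ⟩
    ∑[ i < q ] enum (shift 1# i)          ≈⟨ sum-cong-≋ (λ i → proj₂ (enum-surj (enum i + 1#))) ⟩
    ∑[ i < q ] (enum i + 1#)              ≈⟨ ∑-distrib-+ enum (λ _ → 1#) ⟩
    ∑[ i < q ] enum i + ∑[ i < q ] 1#     ≈⟨ +-congˡ (trans (∑-const q 1#) (*-identityʳ _)) ⟩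
    ∑[ i < q ] enum i + fromℕ q           ∎))
    where
    shift : Carrier → Fin q → Fin q
    shift a i = proj₁ (enum-surj (enum i + a))
    shift-shift : ∀ a b → b + a ≈ 0# → ∀ i → shift a (shift b i) ≡ i
    shift-shift a b b+a≈0 i = enum-inj _ _ (begin
      enum (shift a (shift b i))   ≈⟨ proj₂ (enum-surj _) ⟩
      enum (shift b i) + a         ≈⟨ +-congʳ (proj₂ (enum-surj _)) ⟩
      enum i + b + a               ≈⟨ +-assoc _ _ _ ⟩
      enum i + (b + a)             ≈⟨ +-congˡ b+a≈0 ⟩
      enum i + 0#                  ≈⟨ +-identityʳ _ ⟩
      enum i ∎)
    translate : Permutation q q
    translate = mk↔ₛ′ (shift 1#) (shift (- 1#)) (shift-shift 1# (- 1#) (-‿inverseˡ 1#)) (shift-shift (- 1#) 1# (-‿inverseʳ 1#))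


⌈n/2⌉≤s : ∀ {n s} → n ≤ s ℕ.+ s → ⌈ n /2⌉ ≤ s
⌈n/2⌉≤s {s = s} n≤2s = ℕ.≤-trans (ℕ.⌈n/2⌉-mono n≤2s) (ℕ.≤-reflexive (≡.sym (ℕ.n≡⌈n+n/2⌉ s)))

⌊n/2⌋≤s : ∀ {n s} → n ≤ suc (s ℕ.+ s) → ⌊ n /2⌋ ≤ s
⌊n/2⌋≤s {s = s} n≤1+2s = ℕ.≤-trans (ℕ.⌊n/2⌋-mono n≤1+2s) (ℕ.≤-reflexive (≡.sym (ℕ.n≡⌈n+n/2⌉ s)))

even∧≤1+2s⇒≤2s : ∀ {n s} → n % 2 ≡ 0 → n ≤ suc (s ℕ.+ s) → n ≤ s ℕ.+ s
even∧≤1+2s⇒≤2s {n} {s} n-even n≤1+2s = ℕ.≤-pred (ℕ.≤∧≢⇒< n≤1+2s n≢1+2s)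
  where
  s+s≡s*2 : s ℕ.+ s ≡ s ℕ.* 2
  s+s≡s*2 = ≡.trans (≡.cong (s ℕ.+_) (≡.sym (ℕ.+-identityʳ s))) (ℕ.*-comm 2 s)
  n≢1+2s : ¬ n ≡ suc (s ℕ.+ s)
  n≢1+2s ≡.refl = contradiction
    (≡.trans (≡.sym n-even) (≡.trans (≡.cong (λ k → suc k % 2) s+s≡s*2) ([m+kn]%n≡m%n 1 s 2))) λ ()

odd-prime∤2 : ∀ {p} → Prime p → p % 2 ≡ 1 → ¬ p ∣ 2
odd-prime∤2 p-prime p-odd p∣2 with ∣⇒≤ p∣2
... | z≤n           = ¬prime[0] p-prime
... | s≤s z≤n       = ¬prime[1] p-prime
... | s≤s (s≤s z≤n) = contradiction p-odd λ ()

∣⇒1+n%≡1% : ∀ {p n} .{{_ : NonZero p}} → p ∣ n → suc n % p ≡ 1 % p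
∣⇒1+n%≡1% {p} (divides k ≡.refl) = [m+kn]%n≡m%n 1 k p

mainTheorem11 : ∀ {c ℓ} (p r n : ℕ) .{{_ : NonZero p}} → Prime p → p % 2 ≡ 1 → r ≥ 1 → n ≥ 1 →
  (F : CommutativeRing c ℓ) → IsGF (p ^ r) F →
  (C : Poly.Circuit F n) → Poly.Computes F C (Poly.S2 F n) →
    ((n % 2 ≡ 0 → Poly.gates F C ≥ ⌈ n /2⌉)
    × (n % 2 ≡ 1 → ¬ (n % p ≡ 1 % p ⊎ (suc n) % p ≡ 0 ⊎ n % p ≡ 3 % p) → Poly.gates F C ≥ ⌈ n /2⌉)
    × (n % 2 ≡ 1 → (n % p ≡ 1 % p ⊎ (suc n) % p ≡ 0 ⊎ n % p ≡ 3 % p) → Poly.gates F C ≥ ⌊ n /2⌋))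
mainTheorem11 p r (suc n′) p-prime p-odd _ _ F G C C-computes =
  (λ n-even → ⌈n/2⌉≤s (even∧≤1+2s⇒≤2s {s = length C} n-even n≤1+2s)) ,
  (λ _ n≢1,-1,3 → ⌈n/2⌉≤s (n≤2s (λ p∣n′ → n≢1,-1,3 (inj₁ (∣⇒1+n%≡1% p∣n′))))) ,
  (λ _ _ → ⌊n/2⌋≤s n≤1+2s)
  where
  open CommutativeRing F using (trans; *-congˡ)
  open IntegerCoefficients F using (fromℕ-suc-1≈fromℕ)
  open FiniteField F G using (isDiscreteField; fromℕ-q≈0)
  open DiscreteField F isDiscreteField
  open PolynomialEvaluation F using (computes⇒evalCircuit≈S₂)

  C≈S₂ = computes⇒evalCircuit≈S₂ C C-computes
  invertible = ∤⇒fromℕ-invertible p-prime r fromℕ-q≈0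
  half = invertible (odd-prime∤2 p-prime p-odd)

  n≤1+2s : suc n′ ≤ suc (length C ℕ.+ length C)
  n≤1+2s = circuit⇒n≤1+2s (proj₁ half) (proj₂ half) C C≈S₂

  n≤2s : ¬ p ∣ n′ → suc n′ ≤ length C ℕ.+ length C
  n≤2s p∤n′ = circuit⇒n≤2s (proj₁ half) (proj₂ half) C C≈S₂
                (proj₁ n′⁻¹) (trans (*-congˡ (fromℕ-suc-1≈fromℕ n′)) (proj₂ n′⁻¹))
    where n′⁻¹ = invertible p∤n′
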